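{- Let $m,n$ be positive integers and $k\ge 2$. Let $P(\mathbf{x})=\prod_{i=1}^n\big((x_i-1)^{\underline m}\big)^k$, and expand \[ P=\sum_{((l_1,r_1),\ldots,(l_n,r_n))\in I_k^n}\Big(\prod_{i=1}^n a_{k,l_i,r_i}\Big)\prod_{i=1}^n\big((x_i)^{\underline{m+1}}\big)^{l_i}(x_i+r_i-m-1)^{\underline{r_i}} . \] Let $P_1$ be the sum of those terms of this expansion with $\sum_{i=1}^n l_i\le k-1$ and $\sum_{i=1}^n\big((m+1)l_i+r_i\big)\le mn+(m+1)(k-1)-1$. Then $P_1=P_0$, where $P_0$ is the unique polynomial in $V_{m,k}$ such that $P-P_0$ has zeros of multiplicity at least $k$ at all points of $mB^n\setminus\{\mathbf{0}\}$ and a zero of multiplicity at least $k-1$ at $\mathbf{0}$.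
   Context: Falling factorials: $(y)^{\underline0}=1$, $(y)^{\underline s}=y(y-1)\cdots(y-s+1)$. Let $q_k=\lfloor\frac{mk}{m+1}\rfloor$ and $I_k=\{(0,m)\}\cup\{(l,r):1\le l\le q_k,\ 0\le r\le m\}$. The real numbers $a_{k,l,r}$, $(l,r)\in I_k$, are the unique coefficients with $\big((x-1)^{\underline m}\big)^k=\sum_{(l,r)\in I_k}a_{k,l,r}\big((x)^{\underline{m+1}}\big)^l(x+r-m-1)^{\underline r}$ in $\mathbb{R}[x]$ (for $(l,r)=(0,m)$ the basis polynomial is $(x-1)^{\underline m}$). $mB^n=\{0,1,\ldots,m\}^n$, $\mathbf{0}$ the origin; the multiplicity of $f$ at $\mathbf{a}$ is the minimum total degree of monomials in $f(\mathbf{x}+\mathbf{a})$ ($\infty$ for $f=0$). $V_{m,k}$ is the real vector space of polynomials $Q\in\mathbb{R}[x_1,\ldots,x_n]$ with $\deg Q\le mn+(m+1)(k-1)-1$ such that no monomial of $Q$ is divisible by $x_{i_1}^{m+1}\cdots x_{i_k}^{m+1}$ for any (not necessarily distinct) indices; for every polynomial $P$ there is exactly one $P_0\in V_{m,k}$ with the stated vanishing property. -}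

module Defs where

open import Data.Nat as ℕ using (ℕ; zero; suc; _≤_; _<_; _∸_; _≤ᵇ_)
open import Data.Nat.DivMod using (_/_)
open import Data.Integer using (+_)
open import Data.Rational as ℚ using (ℚ; 0ℚ; 1ℚ)
open import Data.Fin using (Fin)
open import Data.Vec as Vec using (Vec; []; _∷_; replicate; lookup; zipWith; _[_]≔_)
open import Data.Vec.Properties using (≡-dec)
open import Data.List as List using (List; []; _∷_; _++_; map; concat; concatMap; upTo; allFin; foldr; filterᵇ)
open import Data.Product using (_×_; _,_; ∃)
open import Data.Bool using (Bool; _∧_)
open import Relation.Nullary using (¬_; yes; no)
open import Relation.Binary.PropositionalEquality using (_≡_; _≢_)

-- Multivariate polynomials over ℚ in n variables x_0..x_{n-1}, represented
-- as formal finite sums of terms c·x^e.  Two representations denote the same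
-- polynomial iff all coefficients (computed by 'coeff') agree.

Mono : ℕ → Set
Mono n = Vec ℕ n

Poly : ℕ → Set
Poly n = List (ℚ × Mono n)

coeff : ∀ {n} → Poly n → Mono n → ℚ
coeff [] e = 0ℚ
coeff ((c , d) ∷ p) e with ≡-dec ℕ._≟_ d e
... | yes _ = c ℚ.+ coeff p e
... | no  _ = coeff p e

degM : ∀ {n} → Mono n → ℕ
degM = Vec.foldr _ ℕ._+_ 0

ℕtoℚ : ℕ → ℚ
ℕtoℚ k = + k ℚ./ 1

const : ∀ {n} → ℚ → Poly n
const {n} c = (c , replicate n 0) ∷ []

one : ∀ {n} → Poly n
one = const 1ℚ

var : ∀ {n} → Fin n → Poly n
var {n} i = (1ℚ , (replicate n 0 [ i ]≔ 1)) ∷ []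

infixl 6 _⊕_ _⊖_
infixl 7 _⊗_

_⊕_ : ∀ {n} → Poly n → Poly n → Poly n
p ⊕ q = p ++ q

neg : ∀ {n} → Poly n → Poly n
neg = map (λ { (c , d) → (ℚ.- c , d) })

_⊖_ : ∀ {n} → Poly n → Poly n → Poly n
p ⊖ q = p ⊕ neg q

_⊗_ : ∀ {n} → Poly n → Poly n → Poly n
p ⊗ q = concatMap (λ { (c , d) → map (λ { (c' , d') → (c ℚ.* c' , zipWith ℕ._+_ d d') }) q }) p

pow : ∀ {n} → Poly n → ℕ → Poly n
pow p zero = one
pow p (suc k) = pow p k ⊗ p

sumP : ∀ {n} → List (Poly n) → Poly n
sumP = concat

prodP : ∀ {n} → List (Poly n) → Poly n
prodP = foldr _⊗_ one

ff : ∀ {n} → Poly n → ℕ → Poly n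
ff y zero = one
ff y (suc s) = ff y s ⊗ (y ⊖ const (ℕtoℚ s))

shift : ∀ {n} → Poly n → Vec ℕ n → Poly n
shift {n} f a = sumP (map (λ { (c , d) → const c ⊗
  prodP (map (λ i → pow (var i ⊕ const (ℕtoℚ (lookup a i))) (lookup d i)) (allFin n)) }) f)

MultAtLeast : ∀ {n} → Poly n → Vec ℕ n → ℕ → Set
MultAtLeast f a k = ∀ e → degM e < k → coeff (shift f a) e ≡ 0ℚ

q : ℕ → ℕ → ℕ
q m k = (m ℕ.* k) / suc m

I : ℕ → ℕ → List (ℕ × ℕ)
I m k = (0 , m) ∷ concatMap (λ l → map (λ r → (l , r)) (upTo (suc m))) (map suc (upTo (q m k)))

-- ((y)^{\underline{m+1}})^l (y+r-m-1)^{\underline r}; for (l,r)=(0,m) this is (y-1)^{\underline m}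
basis : ∀ {n} → ℕ → Poly n → ℕ × ℕ → Poly n
basis m y (l , r) = pow (ff y (suc m)) l ⊗ ff (y ⊕ const (ℕtoℚ r ℚ.- ℕtoℚ (suc m))) r

x₀ : Poly 1
x₀ = var Fin.zero
  where import Data.Fin as Fin

IsExpansion : ℕ → ℕ → (ℕ → ℕ → ℚ) → Set
IsExpansion m k a =
  ∀ e → coeff (pow (ff (x₀ ⊖ one) m) k) e
      ≡ coeff (sumP (map (λ { (l , r) → const (a l r) ⊗ basis m x₀ (l , r) }) (I m k))) e

tuples : ∀ {A : Set} n → List A → List (Vec A n)
tuples zero xs = [] ∷ []
tuples (suc n) xs = concatMap (λ t → map (_∷ t) xs) (tuples n xs)

P : (m n k : ℕ) → Poly n
P m n k = prodP (map (λ i → pow (ff (var {n} i ⊖ one) m) k) (allFin n))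

term : ∀ {n} → ℕ → (ℕ → ℕ → ℚ) → Vec (ℕ × ℕ) n → Poly n
term {n} m a t =
  const (List.foldr ℚ._*_ 1ℚ (map (λ i → let (l , r) = lookup t i in a l r) (allFin n)))
  ⊗ prodP (map (λ i → basis m (var i) (lookup t i)) (allFin n))

sumL : ∀ {n} → Vec (ℕ × ℕ) n → ℕ
sumL = Vec.foldr _ (λ { (l , r) s → l ℕ.+ s }) 0

sumDeg : ∀ {n} → ℕ → Vec (ℕ × ℕ) n → ℕ
sumDeg m = Vec.foldr _ (λ { (l , r) s → (suc m ℕ.* l ℕ.+ r) ℕ.+ s }) 0

keep : ∀ {n} → ℕ → ℕ → Vec (ℕ × ℕ) n → Bool
keep {n} m k t = (sumL t ≤ᵇ (k ∸ 1)) ∧ (sumDeg m t ≤ᵇ (m ℕ.* n ℕ.+ suc m ℕ.* (k ∸ 1) ∸ 1))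

P₁ : (m n k : ℕ) → (ℕ → ℕ → ℚ) → Poly n
P₁ m n k a = sumP (map (term {n} m a) (filterᵇ (keep m k) (tuples n (I m k))))

powMono : ∀ {n k} → ℕ → Vec (Fin n) k → Mono n
powMono {n} m [] = replicate n 0
powMono {n} m (i ∷ is) = zipWith ℕ._+_ (replicate n 0 [ i ]≔ suc m) (powMono m is)

_∣M_ : ∀ {n} → Mono n → Mono n → Set
d ∣M e = ∀ j → lookup d j ≤ lookup e j

InV : ∀ {n} → ℕ → ℕ → Poly n → Set
InV {n} m k Q = ∀ e → coeff Q e ≢ 0ℚ →
  (degM e ≤ m ℕ.* n ℕ.+ suc m ℕ.* (k ∸ 1) ∸ 1)
  × (¬ ∃ λ (is : Vec (Fin n) k) → powMono m is ∣M e)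

module Submission where

-- Expanding every factor ((x_i - 1)^{\underline m})^k by the one-variable identity writes P as the
-- sum of the terms indexed by I_k^n, so P - P₁ is the sum of the discarded terms.  Translating a
-- point p of mB^n to the origin is a ring homomorphism, so orders of vanishing add up over the
-- factors of a term: each (x_i)^{\underline{m+1}} vanishes at p_i ∈ {0, …, m}, giving order Σ l_i,
-- and when r_i = m the factor (x_i - 1)^{\underline m} vanishes at p_i ≠ 0, giving one more.  A
-- discarded term has Σ l_i ≥ k, or Σ l_i = k - 1 and every r_i = m, hence the multiplicities k
-- off the origin and k - 1 at it.  A kept term only involves monomials with exponent of x_i at
-- most (m+1) l_i + r_i, r_i ≤ m, so of bounded degree and containing at most Σ l_i ≤ k - 1 factors
-- x_j^{m+1}: P₁ lies in V_{m,k}.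

open import Defs
open import Data.Nat using (ℕ; _≤_; _∸_)
open import Data.Rational using (ℚ)
open import Data.Vec using (Vec; replicate)
open import Data.Vec.Relation.Unary.All using (All)
open import Data.Product using (_×_)
open import Relation.Binary.PropositionalEquality using (_≡_; _≢_)

open import Data.Nat as ℕ using (zero; suc; _<_; _≤ᵇ_; z≤n; s≤s)
import Data.Nat.Properties as ℕP
open import Data.Nat.Solver using (module +-*-Solver)
import Data.Integer as ℤ
import Data.Integer.Properties as ℤP
open import Data.Rational as ℚ using (0ℚ; 1ℚ; _+_; _*_)
import Data.Rational.Properties as ℚP
import Data.Rational.Unnormalised as ℚᵘ
import Data.Rational.Unnormalised.Properties as ℚᵘP
open import Data.Rational.Solver as ℚSolver using ()
open import Data.Fin as F using (Fin)
open import Data.Vec as V using ([]; _∷_; lookup; zipWith; _[_]≔_)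
open import Data.Vec.Properties using (≡-dec; lookup-replicate; lookup∘update; lookup∘update′; lookup∘tabulate; tabulate∘lookup; tabulate-cong; lookup-zipWith; zipWith-comm; zipWith-assoc; zipWith-identityˡ)
import Data.Vec.Relation.Unary.All.Properties as VecAllP
open import Data.List as L using (List; []; _∷_; _++_; map; concat; concatMap; foldr; filterᵇ; tabulate; allFin; length)
import Data.List.Properties as LP
open import Data.List.Relation.Unary.All as All using () renaming (All to AllL)
import Data.List.Relation.Unary.All.Properties as AllP
open import Data.Product using (∃; _,_; proj₁; proj₂)
open import Data.Sum using (_⊎_; inj₁; inj₂)
open import Data.Bool using (Bool; true; false; if_then_else_; not; T)
open import Data.Bool.Properties using (T-∧; T-not-≡)
open import Data.Empty using (⊥-elim)
open import Data.Unit using (tt)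
open import Relation.Nullary using (¬_; yes; no; Dec; does)
open import Relation.Nullary.Decidable using (T?)
open import Relation.Binary.PropositionalEquality using (refl; sym; trans; cong; cong₂; subst; subst₂; module ≡-Reasoning)
open import Relation.Binary.Bundles using (Setoid)
import Relation.Binary.Reasoning.Setoid as SetoidReasoning
open import Algebra.Properties.CommutativeMonoid.Sum ℕP.+-0-commutativeMonoid using (sum; ∑-distrib-+)
open import Function using (_∘_; id; Equivalence)

∑ : ∀ {A : Set} → List A → (A → ℚ) → ℚ
∑ [] f = 0ℚ
∑ (x ∷ xs) f = f x + ∑ xs f

∑-map : ∀ {A B : Set} (g : B → A) (xs : List B) f → ∑ (map g xs) f ≡ ∑ xs (f ∘ g)
∑-map g [] f = refl
∑-map g (x ∷ xs) f = cong (f (g x) +_) (∑-map g xs f)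

module _ {A : Set} where

  ∑-++ : ∀ (xs ys : List A) f → ∑ (xs ++ ys) f ≡ ∑ xs f + ∑ ys f
  ∑-++ [] ys f = sym (ℚP.+-identityˡ _)
  ∑-++ (x ∷ xs) ys f = trans (cong (f x +_) (∑-++ xs ys f)) (sym (ℚP.+-assoc (f x) _ _))

  ∑-cong : ∀ (xs : List A) {f g} → (∀ x → f x ≡ g x) → ∑ xs f ≡ ∑ xs g
  ∑-cong [] eq = refl
  ∑-cong (x ∷ xs) eq = cong₂ _+_ (eq x) (∑-cong xs eq)

  ∑-congᴬ : ∀ {P : A → Set} (xs : List A) {f g} → AllL P xs → (∀ x → P x → f x ≡ g x) → ∑ xs f ≡ ∑ xs g
  ∑-congᴬ [] _ eq = refl
  ∑-congᴬ (x ∷ xs) (px All.∷ ps) eq = cong₂ _+_ (eq x px) (∑-congᴬ xs ps eq)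

  ∑-0 : ∀ (xs : List A) → ∑ xs (λ _ → 0ℚ) ≡ 0ℚ
  ∑-0 [] = refl
  ∑-0 (x ∷ xs) = trans (ℚP.+-identityˡ _) (∑-0 xs)

  ∑-vanishes : ∀ {P : A → Set} (xs : List A) {f} → AllL P xs → (∀ x → P x → f x ≡ 0ℚ) → ∑ xs f ≡ 0ℚ
  ∑-vanishes xs ps eq = trans (∑-congᴬ xs ps eq) (∑-0 xs)

  ∑-+ : ∀ (xs : List A) f g → ∑ xs (λ x → f x + g x) ≡ ∑ xs f + ∑ xs g
  ∑-+ [] f g = sym (ℚP.+-identityˡ _)
  ∑-+ (x ∷ xs) f g = trans (cong ((f x + g x) +_) (∑-+ xs f g)) (interchange (f x) (g x) (∑ xs f) (∑ xs g))
    where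
    open ℚSolver.+-*-Solver
    interchange : ∀ a b c d → (a + b) + (c + d) ≡ (a + c) + (b + d)
    interchange = solve 4 (λ a b c d → (a :+ b) :+ (c :+ d) := (a :+ c) :+ (b :+ d)) refl

  ∑-*ˡ : ∀ (xs : List A) c f → ∑ xs (λ x → c * f x) ≡ c * ∑ xs f
  ∑-*ˡ [] c f = sym (ℚP.*-zeroʳ c)
  ∑-*ˡ (x ∷ xs) c f = trans (cong (c * f x +_) (∑-*ˡ xs c f)) (sym (ℚP.*-distribˡ-+ c _ _))

  ∑-neg : ∀ (xs : List A) f → ∑ xs (λ x → ℚ.- f x) ≡ ℚ.- ∑ xs f
  ∑-neg [] f = refl
  ∑-neg (x ∷ xs) f = trans (cong (ℚ.- f x +_) (∑-neg xs f)) (sym (ℚP.neg-distrib-+ (f x) _))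

  ∑-concat : ∀ (xss : List (List A)) f → ∑ (concat xss) f ≡ ∑ xss (λ xs → ∑ xs f)
  ∑-concat [] f = refl
  ∑-concat (xs ∷ xss) f = trans (∑-++ xs (concat xss) f) (cong (∑ xs f +_) (∑-concat xss f))

  ∑-concatMap : ∀ {B : Set} (g : B → List A) (xs : List B) f → ∑ (concatMap g xs) f ≡ ∑ xs (λ x → ∑ (g x) f)
  ∑-concatMap g xs f = trans (∑-concat (map g xs) f) (∑-map g xs _)

  ∑-filter : ∀ (P : A → Bool) (xs : List A) f → ∑ (filterᵇ P xs) f ≡ ∑ xs (λ x → if P x then f x else 0ℚ)
  ∑-filter P [] f = refl
  ∑-filter P (x ∷ xs) f with P x
  ... | true = cong (f x +_) (∑-filter P xs f)
  ... | false = trans (∑-filter P xs f) (sym (ℚP.+-identityˡ _))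

∑-swap : ∀ {A B : Set} (xs : List A) (ys : List B) (f : A → B → ℚ) → ∑ xs (λ x → ∑ ys (f x)) ≡ ∑ ys (λ y → ∑ xs (λ x → f x y))
∑-swap [] ys f = sym (∑-0 ys)
∑-swap (x ∷ xs) ys f = trans (cong (∑ ys (f x) +_) (∑-swap xs ys f)) (sym (∑-+ ys (f x) (λ y → ∑ xs (λ x' → f x' y))))

infixl 6 _⊹_
_⊹_ : ∀ {n} → Mono n → Mono n → Mono n
_⊹_ = zipWith ℕ._+_

𝟎 : ∀ {n} → Mono n
𝟎 {n} = replicate n 0

_≟M_ : ∀ {n} → (d e : Mono n) → Dec (d ≡ e)
_≟M_ = ≡-dec ℕ._≟_

lookup-ext : ∀ {n} {u v : Mono n} → (∀ j → lookup u j ≡ lookup v j) → u ≡ v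
lookup-ext {u = u} {v} h = trans (sym (tabulate∘lookup u)) (trans (tabulate-cong h) (tabulate∘lookup v))

lookup-⊹ : ∀ {n} (d e : Mono n) j → lookup (d ⊹ e) j ≡ lookup d j ℕ.+ lookup e j
lookup-⊹ d e j = lookup-zipWith ℕ._+_ j d e

⊹-comm : ∀ {n} (d e : Mono n) → d ⊹ e ≡ e ⊹ d
⊹-comm = zipWith-comm ℕP.+-comm

⊹-assoc : ∀ {n} (d e f : Mono n) → (d ⊹ e) ⊹ f ≡ d ⊹ (e ⊹ f)
⊹-assoc = zipWith-assoc ℕP.+-assoc

⊹-identityˡ : ∀ {n} (d : Mono n) → 𝟎 ⊹ d ≡ d
⊹-identityˡ = zipWith-identityˡ ℕP.+-identityˡ

degM-⊹ : ∀ {n} (d e : Mono n) → degM (d ⊹ e) ≡ degM d ℕ.+ degM e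
degM-⊹ [] [] = refl
degM-⊹ (x ∷ d) (y ∷ e) = trans (cong ((x ℕ.+ y) ℕ.+_) (degM-⊹ d e)) (interchange x y (degM d) (degM e))
  where
  open +-*-Solver
  interchange : ∀ a b c d → (a ℕ.+ b) ℕ.+ (c ℕ.+ d) ≡ (a ℕ.+ c) ℕ.+ (b ℕ.+ d)
  interchange = solve 4 (λ a b c d → (a :+ b) :+ (c :+ d) := (a :+ c) :+ (b :+ d)) refl

degM-sum : ∀ {n} (e : Mono n) → degM e ≡ sum (lookup e)
degM-sum [] = refl
degM-sum (x ∷ e) = cong (x ℕ.+_) (degM-sum e)

single : ∀ {n} → Fin n → ℕ → Mono n
single i b = 𝟎 [ i ]≔ b

lookup-single : ∀ {n} (i j : Fin n) b → lookup (single i b) j ≡ (if does (i F.≟ j) then b else 0)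
lookup-single i j b with i F.≟ j
... | yes refl = lookup∘update i 𝟎 b
... | no i≢j = trans (lookup∘update′ (i≢j ∘ sym) 𝟎 b) (lookup-replicate j 0)

single-⊹ : ∀ {n} (i : Fin n) a b → single i a ⊹ single i b ≡ single i (a ℕ.+ b)
single-⊹ i a b = lookup-ext λ j → begin
    lookup (single i a ⊹ single i b) j
  ≡⟨ trans (lookup-⊹ (single i a) (single i b) j) (cong₂ ℕ._+_ (lookup-single i j a) (lookup-single i j b)) ⟩
    (if does (i F.≟ j) then a else 0) ℕ.+ (if does (i F.≟ j) then b else 0)
  ≡⟨ if-+ (does (i F.≟ j)) ⟩
    (if does (i F.≟ j) then a ℕ.+ b else 0)
  ≡⟨ sym (lookup-single i j (a ℕ.+ b)) ⟩
    lookup (single i (a ℕ.+ b)) j ∎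
  where
  open ≡-Reasoning
  if-+ : ∀ c → (if c then a else 0) ℕ.+ (if c then b else 0) ≡ (if c then a ℕ.+ b else 0)
  if-+ true = refl
  if-+ false = refl

single-0 : ∀ {n} (i : Fin n) → single i 0 ≡ 𝟎
single-0 i = lookup-ext λ j → trans (lookup-single i j 0) (trans (if-0 (does (i F.≟ j))) (sym (lookup-replicate j 0)))
  where
  if-0 : ∀ c → (if c then 0 else 0) ≡ 0
  if-0 true = refl
  if-0 false = refl

degM-single : ∀ {n} (i : Fin n) b → degM (single i b) ≡ b
degM-single {suc n} F.zero b = trans (cong (b ℕ.+_) (degM-𝟎 n)) (ℕP.+-identityʳ b)
  where
  degM-𝟎 : ∀ n → degM (𝟎 {n}) ≡ 0
  degM-𝟎 zero = refl
  degM-𝟎 (suc n) = degM-𝟎 n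
degM-single {suc n} (F.suc i) b = degM-single i b

δ : ∀ {n} → Mono n → Mono n → ℚ
δ d e = if does (d ≟M e) then 1ℚ else 0ℚ

Term : ℕ → Set
Term n = ℚ × Mono n

linExt : ∀ {n} → (Mono n → ℚ) → Poly n → ℚ
linExt h p = ∑ p (λ x → proj₁ x * h (proj₂ x))

coeffOf : ∀ {n} → Mono n → Term n → ℚ
coeffOf e x = proj₁ x * δ (proj₂ x) e

coeff-∷-≡ : ∀ {n} {c} {d e : Mono n} {p} → d ≡ e → coeff ((c , d) ∷ p) e ≡ c + coeff p e
coeff-∷-≡ {d = d} {e} d≡e with d ≟M e
... | yes _ = refl
... | no d≢e = ⊥-elim (d≢e d≡e)

coeff-∷-≢ : ∀ {n} {c} {d e : Mono n} {p} → d ≢ e → coeff ((c , d) ∷ p) e ≡ coeff p e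
coeff-∷-≢ {d = d} {e} d≢e with d ≟M e
... | yes d≡e = ⊥-elim (d≢e d≡e)
... | no _ = refl

coeff-linExt : ∀ {n} (p : Poly n) e → coeff p e ≡ linExt (λ d → δ d e) p
coeff-linExt [] e = refl
coeff-linExt ((c , d) ∷ p) e with d ≟M e
... | yes _ = cong₂ _+_ (sym (ℚP.*-identityʳ c)) (coeff-linExt p e)
... | no _ = trans (coeff-linExt p e) (sym (trans (cong (_+ _) (ℚP.*-zeroʳ c)) (ℚP.+-identityˡ _)))

linExt-++ : ∀ {n} (h : Mono n → ℚ) p q → linExt h (p ++ q) ≡ linExt h p + linExt h q
linExt-++ h p q = ∑-++ p q _

linExt-neg : ∀ {n} (h : Mono n → ℚ) p → linExt h (neg p) ≡ ℚ.- linExt h p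
linExt-neg h p = trans (∑-map _ p _) (trans (∑-cong p (λ x → sym (ℚP.neg-distribˡ-* (proj₁ x) (h (proj₂ x))))) (∑-neg p _))

coeff-++ : ∀ {n} (p q : Poly n) e → coeff (p ++ q) e ≡ coeff p e + coeff q e
coeff-++ p q e = trans (coeff-linExt (p ++ q) e) (trans (linExt-++ _ p q) (sym (cong₂ _+_ (coeff-linExt p e) (coeff-linExt q e))))

coeff-neg : ∀ {n} (p : Poly n) e → coeff (neg p) e ≡ ℚ.- coeff p e
coeff-neg p e = trans (coeff-linExt (neg p) e) (trans (linExt-neg _ p) (cong ℚ.-_ (sym (coeff-linExt p e))))

removeM : ∀ {n} → Mono n → Poly n → Poly n
removeM d = filterᵇ (λ x → not (does (proj₂ x ≟M d)))

linExt-removeM : ∀ {n} (h : Mono n → ℚ) d p → linExt h p ≡ coeff p d * h d + linExt h (removeM d p)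
linExt-removeM h d [] = sym (trans (ℚP.+-identityʳ _) (ℚP.*-zeroˡ (h d)))
linExt-removeM h d ((c , e) ∷ p) with e ≟M d | linExt-removeM h d p
... | yes refl | ih = trans (cong (c * h e +_) ih) (regroup c (coeff p e) (h e) (linExt h (removeM e p)))
  where
  open ℚSolver.+-*-Solver
  regroup : ∀ c a x r → c * x + (a * x + r) ≡ (c + a) * x + r
  regroup = solve 4 (λ c a x r → c :* x :+ (a :* x :+ r) := (c :+ a) :* x :+ r) refl
... | no _ | ih = trans (cong (c * h e +_) ih) (swap (c * h e) (coeff p d * h d) (linExt h (removeM d p)))
  where
  open ℚSolver.+-*-Solver
  swap : ∀ a b r → a + (b + r) ≡ b + (a + r)
  swap = solve 3 (λ a b r → a :+ (b :+ r) := b :+ (a :+ r)) refl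

coeff-removeM-≡ : ∀ {n} d (p : Poly n) → coeff (removeM d p) d ≡ 0ℚ
coeff-removeM-≡ d [] = refl
coeff-removeM-≡ d ((c , e) ∷ p) with e ≟M d
... | yes _ = coeff-removeM-≡ d p
... | no e≢d = trans (coeff-∷-≢ e≢d) (coeff-removeM-≡ d p)

coeff-removeM-≢ : ∀ {n} {d e : Mono n} (p : Poly n) → e ≢ d → coeff (removeM d p) e ≡ coeff p e
coeff-removeM-≢ [] _ = refl
coeff-removeM-≢ {d = d} {e} ((c , f) ∷ p) e≢d with f ≟M d | f ≟M e
... | yes refl | yes refl = ⊥-elim (e≢d refl)
... | yes _ | no _ = coeff-removeM-≢ p e≢d
... | no _ | yes f≡e = trans (coeff-∷-≡ f≡e) (cong (c +_) (coeff-removeM-≢ p e≢d))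
... | no _ | no f≢e = trans (coeff-∷-≢ f≢e) (coeff-removeM-≢ p e≢d)

length-removeM : ∀ {n} (x : Term n) p → length (removeM (proj₂ x) (x ∷ p)) ≤ length p
length-removeM x p with proj₂ x ≟M proj₂ x
... | yes _ = LP.length-filter (T? ∘ (λ y → not (does (proj₂ y ≟M proj₂ x)))) p
... | no x≢x = ⊥-elim (x≢x refl)

-- Each step removes one monomial from the formal sum, so recursion is on a bound for its length.
linExt-vanishes : ∀ {n} (h : Mono n → ℚ) N (p : Poly n) → length p ≤ N → (∀ e → coeff p e ≡ 0ℚ) → linExt h p ≡ 0ℚ
linExt-vanishes h N [] _ _ = refl
linExt-vanishes h (suc N) (x ∷ p) (s≤s |p|≤N) x∷p≡0 = begin
    linExt h (x ∷ p)
  ≡⟨ linExt-removeM h d (x ∷ p) ⟩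
    coeff (x ∷ p) d * h d + linExt h (removeM d (x ∷ p))
  ≡⟨ cong₂ (λ a b → a * h d + b) (x∷p≡0 d) (linExt-vanishes h N (removeM d (x ∷ p)) (ℕP.≤-trans (length-removeM x p) |p|≤N) removed≡0) ⟩
    0ℚ * h d + 0ℚ
  ≡⟨ trans (ℚP.+-identityʳ _) (ℚP.*-zeroˡ (h d)) ⟩
    0ℚ ∎
  where
  open ≡-Reasoning
  d = proj₂ x
  removed≡0 : ∀ e → coeff (removeM d (x ∷ p)) e ≡ 0ℚ
  removed≡0 e with e ≟M d
  ... | yes refl = coeff-removeM-≡ e (x ∷ p)
  ... | no e≢d = trans (coeff-removeM-≢ (x ∷ p) e≢d) (x∷p≡0 e)

record _≈_ {n} (p q : Poly n) : Set where
  constructor ≈i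
  infixl 20 _!_
  field _!_ : ∀ e → coeff p e ≡ coeff q e
open _≈_ public
infix 4 _≈_

-- Operations defined term by term are linear extensions; this is why they respect ≈.
linExt-resp : ∀ {n} (h : Mono n → ℚ) {p q : Poly n} → p ≈ q → linExt h p ≡ linExt h q
linExt-resp h {p} {q} p≈q = begin
    linExt h p
  ≡⟨ sym (ℚP.+-identityʳ _) ⟩
    linExt h p + 0ℚ
  ≡⟨ cong (linExt h p +_) (sym (ℚP.+-inverseˡ (linExt h q))) ⟩
    linExt h p + (ℚ.- linExt h q + linExt h q)
  ≡⟨ sym (ℚP.+-assoc (linExt h p) _ _) ⟩
    (linExt h p + ℚ.- linExt h q) + linExt h q
  ≡⟨ cong (_+ linExt h q) difference≡0 ⟩
    0ℚ + linExt h q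
  ≡⟨ ℚP.+-identityˡ _ ⟩
    linExt h q ∎
  where
  open ≡-Reasoning
  difference≡0 : linExt h p + ℚ.- linExt h q ≡ 0ℚ
  difference≡0 = trans (cong (linExt h p +_) (sym (linExt-neg h q))) (trans (sym (linExt-++ h p (neg q)))
    (linExt-vanishes h _ (p ++ neg q) ℕP.≤-refl λ e → trans (coeff-++ p (neg q) e)
      (trans (cong₂ _+_ (p≈q ! e) (coeff-neg q e)) (ℚP.+-inverseʳ (coeff q e)))))

≈-refl : ∀ {n} {p : Poly n} → p ≈ p
≈-refl = ≈i λ e → refl

≈-sym : ∀ {n} {p q : Poly n} → p ≈ q → q ≈ p
≈-sym f = ≈i λ e → sym (f ! e)

≈-trans : ∀ {n} {p q r : Poly n} → p ≈ q → q ≈ r → p ≈ r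
≈-trans f g = ≈i λ e → trans (f ! e) (g ! e)

≡⇒≈ : ∀ {n} {p q : Poly n} → p ≡ q → p ≈ q
≡⇒≈ refl = ≈-refl

polySetoid : ℕ → Setoid _ _
polySetoid n = record
  { Carrier = Poly n ; _≈_ = _≈_
  ; isEquivalence = record { refl = ≈-refl ; sym = ≈-sym ; trans = ≈-trans } }

module ≈-Reasoning {n} = SetoidReasoning (polySetoid n)

termMul : ∀ {n} → Term n → Term n → Term n
termMul x y = (proj₁ x * proj₁ y , proj₂ x ⊹ proj₂ y)

∑-⊗ : ∀ {n} (p q : Poly n) f → ∑ (p ⊗ q) f ≡ ∑ p (λ x → ∑ q (λ y → f (termMul x y)))
∑-⊗ p q f = trans (∑-concatMap _ p f) (∑-cong p (λ x → ∑-map _ q f))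

coeff-⊗ : ∀ {n} (p q : Poly n) e → coeff (p ⊗ q) e ≡ ∑ p (λ x → ∑ q (λ y → coeffOf e (termMul x y)))
coeff-⊗ p q e = trans (coeff-linExt (p ⊗ q) e) (∑-⊗ p q _)

coeff-⊗-linExtʳ : ∀ {n} (p q : Poly n) e → coeff (p ⊗ q) e ≡ linExt (λ d → ∑ p (λ x → proj₁ x * δ (proj₂ x ⊹ d) e)) q
coeff-⊗-linExtʳ p q e = trans (coeff-⊗ p q e) (trans (∑-swap p q _) (∑-cong q λ y →
  trans (∑-cong p (λ x → pull (proj₁ x) (proj₁ y) _)) (∑-*ˡ p (proj₁ y) _)))
  where
  open ℚSolver.+-*-Solver
  pull : ∀ a b c → a * b * c ≡ b * (a * c)
  pull = solve 3 (λ a b c → a :* b :* c := b :* (a :* c)) refl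

coeff-⊗-linExtˡ : ∀ {n} (p q : Poly n) e → coeff (p ⊗ q) e ≡ linExt (λ d → ∑ q (λ y → proj₁ y * δ (d ⊹ proj₂ y) e)) p
coeff-⊗-linExtˡ p q e = trans (coeff-⊗ p q e) (∑-cong p λ x →
  trans (∑-cong q (λ y → ℚP.*-assoc (proj₁ x) (proj₁ y) _)) (∑-*ˡ q (proj₁ x) _))

⊕-cong : ∀ {n} {p p' q q' : Poly n} → p ≈ p' → q ≈ q' → p ⊕ q ≈ p' ⊕ q'
⊕-cong {p = p} {p'} {q} {q'} p≈p' q≈q' = ≈i λ e →
  trans (coeff-++ p q e) (trans (cong₂ _+_ (p≈p' ! e) (q≈q' ! e)) (sym (coeff-++ p' q' e)))

neg-cong : ∀ {n} {p q : Poly n} → p ≈ q → neg p ≈ neg q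
neg-cong {p = p} {q} p≈q = ≈i λ e → trans (coeff-neg p e) (trans (cong ℚ.-_ (p≈q ! e)) (sym (coeff-neg q e)))

⊖-cong : ∀ {n} {p p' q q' : Poly n} → p ≈ p' → q ≈ q' → p ⊖ q ≈ p' ⊖ q'
⊖-cong p≈p' q≈q' = ⊕-cong p≈p' (neg-cong q≈q')

-- The coefficients of p ⊗ q are linear extensions both in p and in q.
⊗-cong : ∀ {n} {p p' q q' : Poly n} → p ≈ p' → q ≈ q' → p ⊗ q ≈ p' ⊗ q'
⊗-cong {p = p} {p'} {q} {q'} p≈p' q≈q' = ≈i λ e → begin
    coeff (p ⊗ q) e
  ≡⟨ coeff-⊗-linExtʳ p q e ⟩
    linExt _ q
  ≡⟨ linExt-resp _ q≈q' ⟩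
    linExt _ q'
  ≡⟨ sym (coeff-⊗-linExtʳ p q' e) ⟩
    coeff (p ⊗ q') e
  ≡⟨ coeff-⊗-linExtˡ p q' e ⟩
    linExt _ p
  ≡⟨ linExt-resp _ p≈p' ⟩
    linExt _ p'
  ≡⟨ sym (coeff-⊗-linExtˡ p' q' e) ⟩
    coeff (p' ⊗ q') e ∎
  where open ≡-Reasoning

⊗-comm : ∀ {n} (p q : Poly n) → p ⊗ q ≈ q ⊗ p
⊗-comm p q = ≈i λ e → trans (coeff-⊗ p q e) (trans (∑-swap p q _) (trans (∑-cong q λ y → ∑-cong p λ x →
    cong₂ (λ c d → c * δ d e) (ℚP.*-comm (proj₁ x) (proj₁ y)) (⊹-comm (proj₂ x) (proj₂ y)))
  (sym (coeff-⊗ q p e))))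

⊗-assoc : ∀ {n} (p q r : Poly n) → (p ⊗ q) ⊗ r ≈ p ⊗ (q ⊗ r)
⊗-assoc p q r = ≈i λ e → begin
    coeff ((p ⊗ q) ⊗ r) e
  ≡⟨ coeff-⊗ (p ⊗ q) r e ⟩
    ∑ (p ⊗ q) (λ z → ∑ r (λ w → coeffOf e (termMul z w)))
  ≡⟨ ∑-⊗ p q _ ⟩
    ∑ p (λ x → ∑ q (λ y → ∑ r (λ w → coeffOf e (termMul (termMul x y) w))))
  ≡⟨ ∑-cong p (λ x → ∑-cong q (λ y → ∑-cong r (λ w → cong₂ (λ c d → c * δ d e)
       (ℚP.*-assoc (proj₁ x) (proj₁ y) (proj₁ w)) (⊹-assoc (proj₂ x) (proj₂ y) (proj₂ w))))) ⟩
    ∑ p (λ x → ∑ q (λ y → ∑ r (λ w → coeffOf e (termMul x (termMul y w)))))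
  ≡⟨ ∑-cong p (λ x → sym (∑-⊗ q r _)) ⟩
    ∑ p (λ x → ∑ (q ⊗ r) (λ z → coeffOf e (termMul x z)))
  ≡⟨ sym (coeff-⊗ p (q ⊗ r) e) ⟩
    coeff (p ⊗ (q ⊗ r)) e ∎
  where open ≡-Reasoning

⊗-interchange : ∀ {n} (a b c d : Poly n) → (a ⊗ b) ⊗ (c ⊗ d) ≈ (a ⊗ c) ⊗ (b ⊗ d)
⊗-interchange a b c d = begin
    (a ⊗ b) ⊗ (c ⊗ d)
  ≈⟨ ⊗-assoc a b (c ⊗ d) ⟩
    a ⊗ (b ⊗ (c ⊗ d))
  ≈⟨ ⊗-cong (≈-refl {p = a}) (≈-sym (⊗-assoc b c d)) ⟩
    a ⊗ ((b ⊗ c) ⊗ d)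
  ≈⟨ ⊗-cong (≈-refl {p = a}) (⊗-cong (⊗-comm b c) (≈-refl {p = d})) ⟩
    a ⊗ ((c ⊗ b) ⊗ d)
  ≈⟨ ⊗-cong (≈-refl {p = a}) (⊗-assoc c b d) ⟩
    a ⊗ (c ⊗ (b ⊗ d))
  ≈⟨ ≈-sym (⊗-assoc a c (b ⊗ d)) ⟩
    (a ⊗ c) ⊗ (b ⊗ d) ∎
  where open ≈-Reasoning

⊕-identityʳ : ∀ {n} (p : Poly n) → p ⊕ [] ≈ p
⊕-identityʳ p = ≡⇒≈ (LP.++-identityʳ p)

⊕-assoc : ∀ {n} (p q r : Poly n) → (p ⊕ q) ⊕ r ≈ p ⊕ (q ⊕ r)
⊕-assoc p q r = ≡⇒≈ (LP.++-assoc p q r)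

coeff-const : ∀ {n} (c : ℚ) e → coeff (const {n} c) e ≡ c * δ 𝟎 e
coeff-const c e = trans (coeff-linExt (const c) e) (ℚP.+-identityʳ _)

coeff-const-⊗ : ∀ {n} (c : ℚ) (p : Poly n) e → coeff (const c ⊗ p) e ≡ c * coeff p e
coeff-const-⊗ c p e = trans (coeff-⊗-linExtˡ (const c) p e) (trans (ℚP.+-identityʳ _) (cong (c *_)
  (trans (∑-cong p (λ y → cong (λ d → proj₁ y * δ d e) (⊹-identityˡ (proj₂ y)))) (sym (coeff-linExt p e)))))

⊗-identityˡ : ∀ {n} (p : Poly n) → one ⊗ p ≈ p
⊗-identityˡ p = ≈i λ e → trans (coeff-const-⊗ 1ℚ p e) (ℚP.*-identityˡ _)

⊗-identityʳ : ∀ {n} (p : Poly n) → p ⊗ one ≈ p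
⊗-identityʳ p = ≈-trans (⊗-comm p one) (⊗-identityˡ p)

const-⊗-const : ∀ {n} (a b : ℚ) → const {n} a ⊗ const b ≈ const (a * b)
const-⊗-const a b = ≈i λ e → trans (coeff-const-⊗ a (const b) e)
  (trans (cong (a *_) (coeff-const b e)) (trans (sym (ℚP.*-assoc a b _)) (sym (coeff-const (a * b) e))))

const-⊕-const : ∀ {n} (a b : ℚ) → const {n} a ⊕ const b ≈ const (a + b)
const-⊕-const a b = ≈i λ e → trans (coeff-++ (const a) (const b) e)
  (trans (cong₂ _+_ (coeff-const a e) (coeff-const b e)) (trans (sym (ℚP.*-distribʳ-+ _ a b)) (sym (coeff-const (a + b) e))))

const-0 : ∀ {n} → const {n} 0ℚ ≈ []
const-0 = ≈i λ e → trans (coeff-const 0ℚ e) (ℚP.*-zeroˡ (δ 𝟎 e))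

⊕-const-⊖-const : ∀ {n} (y : Poly n) (a b : ℚ) → a + ℚ.- b ≡ 0ℚ → (y ⊕ const a) ⊖ const b ≈ y
⊕-const-⊖-const y a b a-b≡0 = begin
    (y ⊕ const a) ⊕ neg (const b)
  ≈⟨ ⊕-assoc y (const a) (neg (const b)) ⟩
    y ⊕ (const a ⊕ const (ℚ.- b))
  ≈⟨ ⊕-cong ≈-refl (≈-trans (const-⊕-const a (ℚ.- b)) (≈-trans (≡⇒≈ (cong const a-b≡0)) const-0)) ⟩
    y ⊕ []
  ≈⟨ ⊕-identityʳ y ⟩
    y ∎
  where open ≈-Reasoning

pow-cong : ∀ {n} {p q : Poly n} k → p ≈ q → pow p k ≈ pow q k
pow-cong zero p≈q = ≈-refl
pow-cong (suc k) p≈q = ⊗-cong (pow-cong k p≈q) p≈q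

ff-cong : ∀ {n} {p q : Poly n} k → p ≈ q → ff p k ≈ ff q k
ff-cong zero p≈q = ≈-refl
ff-cong (suc k) p≈q = ⊗-cong (ff-cong k p≈q) (⊖-cong p≈q ≈-refl)

pow-+ : ∀ {n} (y : Poly n) a b → pow y (a ℕ.+ b) ≈ pow y a ⊗ pow y b
pow-+ y zero b = ≈-sym (⊗-identityˡ (pow y b))
pow-+ y (suc a) b = begin
    pow y (a ℕ.+ b) ⊗ y
  ≈⟨ ⊗-cong (pow-+ y a b) ≈-refl ⟩
    (pow y a ⊗ pow y b) ⊗ y
  ≈⟨ ⊗-assoc (pow y a) (pow y b) y ⟩
    pow y a ⊗ (pow y b ⊗ y)
  ≈⟨ ⊗-cong (≈-refl {p = pow y a}) (⊗-comm (pow y b) y) ⟩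
    pow y a ⊗ (y ⊗ pow y b)
  ≈⟨ ≈-sym (⊗-assoc (pow y a) y (pow y b)) ⟩
    (pow y a ⊗ y) ⊗ pow y b ∎
  where open ≈-Reasoning

coeff-sumP : ∀ {n} {A : Set} (f : A → Poly n) (xs : List A) e → coeff (sumP (map f xs)) e ≡ ∑ xs (λ x → coeff (f x) e)
coeff-sumP f xs e = trans (coeff-linExt (sumP (map f xs)) e)
  (trans (∑-concat (map f xs) _) (trans (∑-map f xs _) (∑-cong xs (λ x → sym (coeff-linExt (f x) e)))))

coeff-sumP-⊗ : ∀ {n} {A : Set} (f : A → Poly n) (xs : List A) (q : Poly n) e → coeff (sumP (map f xs) ⊗ q) e ≡ ∑ xs (λ x → coeff (f x ⊗ q) e)
coeff-sumP-⊗ f xs q e = trans (coeff-⊗ (sumP (map f xs)) q e)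
  (trans (∑-concat (map f xs) _) (trans (∑-map f xs _) (∑-cong xs (λ x → sym (coeff-⊗ (f x) q e)))))

coeff-⊗-sumP : ∀ {n} {A : Set} (q : Poly n) (f : A → Poly n) (xs : List A) e → coeff (q ⊗ sumP (map f xs)) e ≡ ∑ xs (λ x → coeff (q ⊗ f x) e)
coeff-⊗-sumP q f xs e = trans (⊗-comm q _ ! e) (trans (coeff-sumP-⊗ f xs q e) (∑-cong xs (λ x → ⊗-comm (f x) q ! e)))

sumP-cong : ∀ {n} {A : Set} {f g : A → Poly n} (xs : List A) → (∀ x → f x ≈ g x) → sumP (map f xs) ≈ sumP (map g xs)
sumP-cong {f = f} {g} xs f≈g = ≈i λ e → trans (coeff-sumP f xs e) (trans (∑-cong xs (λ x → f≈g x ! e)) (sym (coeff-sumP g xs e)))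

prodP-cong : ∀ {n} {A : Set} (xs : List A) {f g : A → Poly n} → (∀ x → f x ≈ g x) → prodP (map f xs) ≈ prodP (map g xs)
prodP-cong [] f≈g = ≈-refl
prodP-cong (x ∷ xs) f≈g = ⊗-cong (f≈g x) (prodP-cong xs f≈g)

prodP-⊗ : ∀ {n} {A : Set} (xs : List A) (f g : A → Poly n) → prodP (map (λ x → f x ⊗ g x) xs) ≈ prodP (map f xs) ⊗ prodP (map g xs)
prodP-⊗ [] f g = ≈-sym (⊗-identityˡ one)
prodP-⊗ (x ∷ xs) f g = ≈-trans (⊗-cong (≈-refl {p = f x ⊗ g x}) (prodP-⊗ xs f g)) (⊗-interchange (f x) (g x) _ _)

prodP-one : ∀ {n} {A : Set} (xs : List A) (f : A → Poly n) → (∀ x → f x ≈ one) → prodP (map f xs) ≈ one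
prodP-one [] f f≈1 = ≈-refl
prodP-one (x ∷ xs) f f≈1 = ≈-trans (⊗-cong (f≈1 x) (prodP-one xs f f≈1)) (⊗-identityˡ one)

prodP-const-⊗ : ∀ {n n'} (c : Fin n' → ℚ) (b : Fin n' → Poly n) →
  prodP (tabulate (λ i → const (c i) ⊗ b i)) ≈ const (foldr _*_ 1ℚ (tabulate c)) ⊗ prodP (tabulate b)
prodP-const-⊗ {n' = zero} c b = ≈-sym (⊗-identityˡ one)
prodP-const-⊗ {n' = suc n'} c b = ≈-trans (⊗-cong (≈-refl {p = const (c F.zero) ⊗ b F.zero}) (prodP-const-⊗ (c ∘ F.suc) (b ∘ F.suc)))
  (≈-trans (⊗-interchange (const (c F.zero)) (b F.zero) (const c′) (prodP (tabulate (b ∘ F.suc))))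
           (⊗-cong (const-⊗-const (c F.zero) c′) (≈-refl {p = b F.zero ⊗ prodP (tabulate (b ∘ F.suc))})))
  where c′ = foldr _*_ 1ℚ (tabulate (c ∘ F.suc))

map-allFin : ∀ {n} {A : Set} (f : Fin n → A) → map f (allFin n) ≡ tabulate f
map-allFin f = LP.map-tabulate id f

module _ {n : ℕ} (a : Vec ℕ n) where

  shiftedVar : Fin n → Poly n
  shiftedVar i = var i ⊕ const (ℕtoℚ (lookup a i))

  shiftedMono : Mono n → Poly n
  shiftedMono d = prodP (map (λ i → pow (shiftedVar i) (lookup d i)) (allFin n))

  shiftedTerm : Term n → Poly n
  shiftedTerm x = const (proj₁ x) ⊗ shiftedMono (proj₂ x)

  coeff-shift : ∀ f e → coeff (shift f a) e ≡ linExt (λ d → coeff (shiftedMono d) e) f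
  coeff-shift f e = trans (coeff-sumP shiftedTerm f e) (∑-cong f (λ x → coeff-const-⊗ (proj₁ x) (shiftedMono (proj₂ x)) e))

  shift-cong : ∀ {f g} → f ≈ g → shift f a ≈ shift g a
  shift-cong {f} {g} f≈g = ≈i λ e → trans (coeff-shift f e) (trans (linExt-resp _ f≈g) (sym (coeff-shift g e)))

  shift-⊕ : ∀ f g → shift (f ⊕ g) a ≈ shift f a ⊕ shift g a
  shift-⊕ f g = ≈i λ e → trans (coeff-shift (f ⊕ g) e) (trans (linExt-++ _ f g)
    (trans (cong₂ _+_ (sym (coeff-shift f e)) (sym (coeff-shift g e))) (sym (coeff-++ (shift f a) (shift g a) e))))

  shift-neg : ∀ f → shift (neg f) a ≈ neg (shift f a)
  shift-neg f = ≈i λ e → trans (coeff-shift (neg f) e) (trans (linExt-neg _ f)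
    (trans (cong ℚ.-_ (sym (coeff-shift f e))) (sym (coeff-neg (shift f a) e))))

  shift-⊖ : ∀ f g → shift (f ⊖ g) a ≈ shift f a ⊖ shift g a
  shift-⊖ f g = ≈-trans (shift-⊕ f (neg g)) (⊕-cong (≈-refl {p = shift f a}) (shift-neg g))

  shift-sumP : ∀ {A : Set} (f : A → Poly n) xs → shift (sumP (map f xs)) a ≈ sumP (map (λ x → shift (f x) a) xs)
  shift-sumP f [] = ≈-refl
  shift-sumP f (x ∷ xs) = ≈-trans (shift-⊕ (f x) _) (⊕-cong (≈-refl {p = shift (f x) a}) (shift-sumP f xs))

  shiftedMono-⊹ : ∀ d d' → shiftedMono (d ⊹ d') ≈ shiftedMono d ⊗ shiftedMono d'
  shiftedMono-⊹ d d' = ≈-trans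
    (prodP-cong (allFin n) λ i → ≈-trans (≡⇒≈ (cong (pow (shiftedVar i)) (lookup-⊹ d d' i))) (pow-+ (shiftedVar i) (lookup d i) (lookup d' i)))
    (prodP-⊗ (allFin n) (λ i → pow (shiftedVar i) (lookup d i)) (λ i → pow (shiftedVar i) (lookup d' i)))

  shiftedTerm-termMul : ∀ x y → shiftedTerm x ⊗ shiftedTerm y ≈ shiftedTerm (termMul x y)
  shiftedTerm-termMul x y = ≈-trans (⊗-interchange (const (proj₁ x)) (shiftedMono (proj₂ x)) (const (proj₁ y)) (shiftedMono (proj₂ y)))
    (⊗-cong (const-⊗-const (proj₁ x) (proj₁ y)) (≈-sym (shiftedMono-⊹ (proj₂ x) (proj₂ y))))

  shift-⊗ : ∀ f g → shift (f ⊗ g) a ≈ shift f a ⊗ shift g a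
  shift-⊗ f g = ≈i λ e → begin
      coeff (shift (f ⊗ g) a) e
    ≡⟨ coeff-sumP shiftedTerm (f ⊗ g) e ⟩
      ∑ (f ⊗ g) (λ z → coeff (shiftedTerm z) e)
    ≡⟨ ∑-⊗ f g _ ⟩
      ∑ f (λ x → ∑ g (λ y → coeff (shiftedTerm (termMul x y)) e))
    ≡⟨ ∑-cong f (λ x → ∑-cong g (λ y → sym (shiftedTerm-termMul x y ! e))) ⟩
      ∑ f (λ x → ∑ g (λ y → coeff (shiftedTerm x ⊗ shiftedTerm y) e))
    ≡⟨ ∑-cong f (λ x → sym (coeff-⊗-sumP (shiftedTerm x) shiftedTerm g e)) ⟩
      ∑ f (λ x → coeff (shiftedTerm x ⊗ shift g a) e)
    ≡⟨ sym (coeff-sumP-⊗ shiftedTerm f (shift g a) e) ⟩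
      coeff (shift f a ⊗ shift g a) e ∎
    where open ≡-Reasoning

  shift-const : ∀ c → shift (const c) a ≈ const c
  shift-const c = ≈-trans (⊕-identityʳ (shiftedTerm (c , 𝟎)))
    (≈-trans (⊗-cong (≈-refl {p = const c}) shiftedMono-𝟎) (⊗-identityʳ (const c)))
    where
    shiftedMono-𝟎 : shiftedMono 𝟎 ≈ one
    shiftedMono-𝟎 = prodP-one (allFin n) _ (λ i → ≡⇒≈ (cong (pow (shiftedVar i)) (lookup-replicate i 0)))

  shift-pow : ∀ y k → shift (pow y k) a ≈ pow (shift y a) k
  shift-pow y zero = shift-const 1ℚ
  shift-pow y (suc k) = ≈-trans (shift-⊗ (pow y k) y) (⊗-cong (shift-pow y k) (≈-refl {p = shift y a}))

  shift-ff : ∀ y s → shift (ff y s) a ≈ ff (shift y a) s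
  shift-ff y zero = shift-const 1ℚ
  shift-ff y (suc s) = ≈-trans (shift-⊗ (ff y s) _)
    (⊗-cong (shift-ff y s) (≈-trans (shift-⊖ y (const (ℕtoℚ s))) (⊖-cong (≈-refl {p = shift y a}) (shift-const (ℕtoℚ s)))))

  shift-prodP : ∀ {A : Set} (xs : List A) (f : A → Poly n) → shift (prodP (map f xs)) a ≈ prodP (map (λ x → shift (f x) a) xs)
  shift-prodP [] f = shift-const 1ℚ
  shift-prodP (x ∷ xs) f = ≈-trans (shift-⊗ (f x) _) (⊗-cong (≈-refl {p = shift (f x) a}) (shift-prodP xs f))

prodP-pow-single : ∀ {n n'} (g : Fin n' → Poly n) (i : Fin n') → prodP (tabulate (λ j → pow (g j) (lookup (single i 1) j))) ≈ g i
prodP-pow-single g F.zero = ≈-trans (⊗-cong (⊗-identityˡ (g F.zero)) rest≈1) (⊗-identityʳ (g F.zero))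
  where
  rest≈1 : prodP (tabulate (λ j → pow (g (F.suc j)) (lookup 𝟎 j))) ≈ one
  rest≈1 = ≈-trans (≡⇒≈ (cong prodP (sym (map-allFin (λ j → pow (g (F.suc j)) (lookup 𝟎 j))))))
    (prodP-one (allFin _) _ (λ j → ≡⇒≈ (cong (pow (g (F.suc j))) (lookup-replicate j 0))))
prodP-pow-single g (F.suc i) = ≈-trans (⊗-identityˡ _) (prodP-pow-single (g ∘ F.suc) i)

shift-var : ∀ {n} (a : Vec ℕ n) i → shift (var i) a ≈ shiftedVar a i
shift-var a i = ≈-trans (⊕-identityʳ _) (≈-trans (⊗-identityˡ _)
  (≈-trans (≡⇒≈ (cong prodP (map-allFin (λ j → pow (shiftedVar a j) (lookup (single i 1) j))))) (prodP-pow-single (shiftedVar a) i)))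

record OrderAtLeast {n} (k : ℕ) (f : Poly n) : Set where
  constructor orderAtLeast
  field vanish : ∀ e → degM e < k → coeff f e ≡ 0ℚ
open OrderAtLeast public

OrderAtLeast-resp : ∀ {n} {f g : Poly n} {k} → f ≈ g → OrderAtLeast k f → OrderAtLeast k g
OrderAtLeast-resp f≈g o = orderAtLeast λ e lt → trans (sym (f≈g ! e)) (vanish o e lt)

OrderAtLeast-weaken : ∀ {n} {f : Poly n} {j k} → j ≤ k → OrderAtLeast k f → OrderAtLeast j f
OrderAtLeast-weaken j≤k o = orderAtLeast λ e lt → vanish o e (ℕP.<-≤-trans lt j≤k)

OrderAtLeast-0 : ∀ {n} (f : Poly n) → OrderAtLeast 0 f
OrderAtLeast-0 f = orderAtLeast λ e ()

AllMonos : ∀ {n} → (Mono n → Set) → Poly n → Set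
AllMonos S p = AllL (λ x → S (proj₂ x)) p

coeff-outside : ∀ {n} {S : Mono n → Set} {p e} → AllMonos S p → ¬ S e → coeff p e ≡ 0ℚ
coeff-outside {p = []} All.[] ¬Se = refl
coeff-outside {S = S} {p = (c , d) ∷ p} (Sd All.∷ Sp) ¬Se =
  trans (coeff-∷-≢ (λ d≡e → ¬Se (subst S d≡e Sd))) (coeff-outside Sp ¬Se)

coeff≢0⇒inside : ∀ {n} {S : Mono n → Set} {p e} → AllMonos S p → coeff p e ≢ 0ℚ → S e
coeff≢0⇒inside {p = []} All.[] coeff≢0 = ⊥-elim (coeff≢0 refl)
coeff≢0⇒inside {S = S} {p = (c , d) ∷ p} {e} (Sd All.∷ Sp) coeff≢0 with d ≟M e
... | yes d≡e = subst S d≡e Sd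
... | no _ = coeff≢0⇒inside Sp coeff≢0

AllMonos-++ : ∀ {n} {S : Mono n → Set} {p q} → AllMonos S p → AllMonos S q → AllMonos S (p ⊕ q)
AllMonos-++ = AllP.++⁺

AllMonos-⊗ : ∀ {n} {S T U : Mono n → Set} {p q} → AllMonos S p → AllMonos T q →
  (∀ d d' → S d → T d' → U (d ⊹ d')) → AllMonos U (p ⊗ q)
AllMonos-⊗ All.[] Tq ST⇒U = All.[]
AllMonos-⊗ (Sx All.∷ Sp) Tq ST⇒U = AllP.++⁺ (AllP.map⁺ (All.map (ST⇒U _ _ Sx) Tq)) (AllMonos-⊗ Sp Tq ST⇒U)

AllMonos-sumP : ∀ {n} {A : Set} {S : Mono n → Set} (f : A → Poly n) (xs : List A) → AllL (AllMonos S ∘ f) xs → AllMonos S (sumP (map f xs))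
AllMonos-sumP f [] All.[] = All.[]
AllMonos-sumP f (x ∷ xs) (Sfx All.∷ Sfxs) = AllMonos-++ Sfx (AllMonos-sumP f xs Sfxs)

coeff-filter-kept : ∀ {n} (P : Mono n → Bool) (f : Poly n) {e} → P e ≡ true → coeff (filterᵇ (P ∘ proj₂) f) e ≡ coeff f e
coeff-filter-kept P [] Pe = refl
coeff-filter-kept P ((c , d) ∷ f) {e} Pe with d ≟M e
... | yes refl rewrite Pe = trans (coeff-∷-≡ {c = c} {d = d} {p = filterᵇ (P ∘ proj₂) f} refl) (cong (c +_) (coeff-filter-kept P f Pe))
... | no d≢e with P d
...   | true = trans (coeff-∷-≢ d≢e) (coeff-filter-kept P f Pe)
...   | false = coeff-filter-kept P f Pe

dropBelow : ∀ {n} → ℕ → Poly n → Poly n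
dropBelow a = filterᵇ (λ x → a ≤ᵇ degM (proj₂ x))

AllMonos-dropBelow : ∀ {n} a (f : Poly n) → AllMonos (λ d → a ≤ degM d) (dropBelow a f)
AllMonos-dropBelow a f = All.map (ℕP.≤ᵇ⇒≤ a _) (AllP.all-filter (T? ∘ (λ x → a ≤ᵇ degM (proj₂ x))) f)

dropBelow-≈ : ∀ {n} {a} {f : Poly n} → OrderAtLeast a f → f ≈ dropBelow a f
dropBelow-≈ {a = a} {f} o = ≈i λ e → keptOrZero e (a ≤ᵇ degM e) refl
  where
  keptOrZero : ∀ e b → (a ≤ᵇ degM e) ≡ b → coeff f e ≡ coeff (dropBelow a f) e
  keptOrZero e true a≤e = sym (coeff-filter-kept (λ d → a ≤ᵇ degM d) f a≤e)
  keptOrZero e false a≰e = trans (vanish o e e<a) (sym (coeff-outside (AllMonos-dropBelow a f) (ℕP.<⇒≱ e<a)))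
    where e<a = ℕP.≰⇒> λ a≤ → subst T a≰e (ℕP.≤⇒≤ᵇ a≤)

OrderAtLeast-⊗ : ∀ {n} {a b} {f g : Poly n} → OrderAtLeast a f → OrderAtLeast b g → OrderAtLeast (a ℕ.+ b) (f ⊗ g)
OrderAtLeast-⊗ {a = a} {b} {f} {g} of og = orderAtLeast λ e lt → trans (⊗-cong (dropBelow-≈ of) (dropBelow-≈ og) ! e)
  (coeff-outside (AllMonos-⊗ (AllMonos-dropBelow a f) (AllMonos-dropBelow b g) degree-adds) (ℕP.<⇒≱ lt))
  where
  degree-adds : ∀ d d' → a ≤ degM d → b ≤ degM d' → a ℕ.+ b ≤ degM (d ⊹ d')
  degree-adds d d' a≤ b≤ = subst (a ℕ.+ b ≤_) (sym (degM-⊹ d d')) (ℕP.+-mono-≤ a≤ b≤)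

OrderAtLeast-pow : ∀ {n} {a} {f : Poly n} l → OrderAtLeast a f → OrderAtLeast (l ℕ.* a) (pow f l)
OrderAtLeast-pow zero o = OrderAtLeast-0 _
OrderAtLeast-pow {a = a} (suc l) o = OrderAtLeast-weaken (ℕP.≤-reflexive (ℕP.+-comm a (l ℕ.* a))) (OrderAtLeast-⊗ (OrderAtLeast-pow l o) o)

OrderAtLeast-const-⊗ : ∀ {n} {k} c {f : Poly n} → OrderAtLeast k f → OrderAtLeast k (const c ⊗ f)
OrderAtLeast-const-⊗ c o = OrderAtLeast-⊗ (OrderAtLeast-0 (const c)) o

OrderAtLeast-prodP : ∀ {n n'} (g : Fin n' → Poly n) (k : Fin n' → ℕ) → (∀ i → OrderAtLeast (k i) (g i)) → OrderAtLeast (sum k) (prodP (tabulate g))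
OrderAtLeast-prodP {n' = zero} g k o = OrderAtLeast-0 one
OrderAtLeast-prodP {n' = suc n'} g k o = OrderAtLeast-⊗ (o F.zero) (OrderAtLeast-prodP (g ∘ F.suc) (k ∘ F.suc) (o ∘ F.suc))

OrderAtLeast-var : ∀ {n} (i : Fin n) → OrderAtLeast 1 (var i)
OrderAtLeast-var i = orderAtLeast λ e lt →
  coeff-outside {S = λ d → 1 ≤ degM d} {p = var i} (ℕP.≤-reflexive (sym (degM-single i 1)) All.∷ All.[]) (ℕP.<⇒≱ lt)

OrderAtLeast-ff : ∀ {n} (y : Poly n) s j → j < s → OrderAtLeast 1 (y ⊖ const (ℕtoℚ j)) → OrderAtLeast 1 (ff y s)
OrderAtLeast-ff y (suc s) j j<1+s o with j ℕ.≟ s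
... | yes refl = OrderAtLeast-⊗ (OrderAtLeast-0 (ff y s)) o
... | no j≢s = OrderAtLeast-weaken (s≤s z≤n) (OrderAtLeast-⊗ (OrderAtLeast-ff y s j (ℕP.≤∧≢⇒< (ℕP.≤-pred j<1+s) j≢s) o) (OrderAtLeast-0 _))

embed : ∀ {n} → Fin n → Poly 1 → Poly n
embed i = map (λ x → (proj₁ x , single i (lookup (proj₂ x) F.zero)))

coeff-embed : ∀ {n} (i : Fin n) p e → coeff (embed i p) e ≡ linExt (λ d → δ (single i (lookup d F.zero)) e) p
coeff-embed i p e = trans (coeff-linExt (embed i p) e) (∑-map _ p _)

embed-cong : ∀ {n} (i : Fin n) {p q} → p ≈ q → embed i p ≈ embed i q
embed-cong i {p} {q} p≈q = ≈i λ e → trans (coeff-embed i p e) (trans (linExt-resp _ p≈q) (sym (coeff-embed i q e)))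

embed-⊕ : ∀ {n} (i : Fin n) p q → embed i (p ⊕ q) ≡ embed i p ⊕ embed i q
embed-⊕ i p q = LP.map-++ _ p q

embed-neg : ∀ {n} (i : Fin n) p → embed i (neg p) ≡ neg (embed i p)
embed-neg i p = trans (sym (LP.map-∘ p)) (LP.map-∘ p)

embed-⊗ : ∀ {n} (i : Fin n) p q → embed i (p ⊗ q) ≈ embed i p ⊗ embed i q
embed-⊗ i p q = ≈i λ e → trans (coeff-embed i (p ⊗ q) e) (trans (∑-⊗ p q _) (sym (trans (coeff-⊗ (embed i p) (embed i q) e)
  (trans (∑-map _ p _) (∑-cong p λ x → trans (∑-map _ q _) (∑-cong q λ y →
    cong (λ d → (proj₁ x * proj₁ y) * δ d e) (single-⊹-lookup (proj₂ x) (proj₂ y))))))))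
  where
  single-⊹-lookup : ∀ (d d' : Mono 1) → single i (lookup d F.zero) ⊹ single i (lookup d' F.zero) ≡ single i (lookup (d ⊹ d') F.zero)
  single-⊹-lookup (x ∷ []) (y ∷ []) = single-⊹ i x y

embed-const : ∀ {n} (i : Fin n) c → embed i (const c) ≡ const c
embed-const i c = cong (λ d → (c , d) ∷ []) (single-0 i)

embed-pow : ∀ {n} (i : Fin n) y k → embed i (pow y k) ≈ pow (embed i y) k
embed-pow i y zero = ≡⇒≈ (embed-const i 1ℚ)
embed-pow i y (suc k) = ≈-trans (embed-⊗ i (pow y k) y) (⊗-cong (embed-pow i y k) (≈-refl {p = embed i y}))

embed-⊕-const : ∀ {n} (i : Fin n) y c → embed i (y ⊕ const c) ≡ embed i y ⊕ const c
embed-⊕-const i y c = trans (embed-⊕ i y (const c)) (cong (embed i y ⊕_) (embed-const i c))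

embed-⊖-const : ∀ {n} (i : Fin n) y c → embed i (y ⊖ const c) ≡ embed i y ⊖ const c
embed-⊖-const i y c = trans (embed-⊕ i y (neg (const c))) (cong (embed i y ⊕_) (trans (embed-neg i (const c)) (cong neg (embed-const i c))))

embed-ff : ∀ {n} (i : Fin n) y s → embed i (ff y s) ≈ ff (embed i y) s
embed-ff i y zero = ≡⇒≈ (embed-const i 1ℚ)
embed-ff i y (suc s) = ≈-trans (embed-⊗ i (ff y s) _) (⊗-cong (embed-ff i y s) (≡⇒≈ (embed-⊖-const i y (ℕtoℚ s))))

embed-basis : ∀ {n} (i : Fin n) m t → embed i (basis m x₀ t) ≈ basis m (var i) t
embed-basis i m (l , r) = ≈-trans (embed-⊗ i (pow (ff x₀ (suc m)) l) (ff (x₀ ⊕ const c) r))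
  (⊗-cong (≈-trans (embed-pow i (ff x₀ (suc m)) l) (pow-cong l (embed-ff i x₀ (suc m))))
          (≈-trans (embed-ff i (x₀ ⊕ const c) r) (ff-cong r (≡⇒≈ (embed-⊕-const i x₀ c)))))
  where c = ℕtoℚ r ℚ.- ℕtoℚ (suc m)

embed-sumP : ∀ {n} {A : Set} (i : Fin n) (f : A → Poly 1) (xs : List A) → embed i (sumP (map f xs)) ≡ sumP (map (embed i ∘ f) xs)
embed-sumP i f [] = refl
embed-sumP i f (x ∷ xs) = trans (embed-⊕ i (f x) _) (cong (embed i (f x) ++_) (embed-sumP i f xs))

prodP-sumP : ∀ {n n'} {A : Set} (g : Fin n' → Poly n) (f : Fin n' → A → Poly n) (xs : List A) → (∀ i → g i ≈ sumP (map (f i) xs)) →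
  prodP (tabulate g) ≈ sumP (map (λ t → prodP (tabulate (λ i → f i (lookup t i)))) (tuples n' xs))
prodP-sumP {n' = zero} g f xs g≈ = ≈-sym (⊕-identityʳ one)
prodP-sumP {n' = suc n'} g f xs g≈ = ≈i λ e → begin
    coeff (g F.zero ⊗ prodP (tabulate (g ∘ F.suc))) e
  ≡⟨ ⊗-cong (g≈ F.zero) (prodP-sumP (g ∘ F.suc) (f ∘ F.suc) xs (g≈ ∘ F.suc)) ! e ⟩
    coeff (sumP (map (f F.zero) xs) ⊗ sumP (map tail ts)) e
  ≡⟨ coeff-sumP-⊗ (f F.zero) xs _ e ⟩
    ∑ xs (λ x → coeff (f F.zero x ⊗ sumP (map tail ts)) e)
  ≡⟨ ∑-cong xs (λ x → coeff-⊗-sumP (f F.zero x) tail ts e) ⟩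
    ∑ xs (λ x → ∑ ts (λ t → coeff (whole (x ∷ t)) e))
  ≡⟨ ∑-swap xs ts _ ⟩
    ∑ ts (λ t → ∑ xs (λ x → coeff (whole (x ∷ t)) e))
  ≡⟨ ∑-cong ts (λ t → sym (∑-map (_∷ t) xs _)) ⟩
    ∑ ts (λ t → ∑ (map (_∷ t) xs) (λ v → coeff (whole v) e))
  ≡⟨ sym (∑-concatMap (λ t → map (_∷ t) xs) ts _) ⟩
    ∑ (tuples (suc n') xs) (λ v → coeff (whole v) e)
  ≡⟨ sym (coeff-sumP whole (tuples (suc n') xs) e) ⟩
    coeff (sumP (map whole (tuples (suc n') xs))) e ∎
  where
  open ≡-Reasoning
  ts = tuples n' xs
  tail = λ t → prodP (tabulate (λ i → f (F.suc i) (lookup t i)))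
  whole = λ t → prodP (tabulate (λ i → f i (lookup t i)))

sumP-⊖-filter : ∀ {n} {A : Set} (f : A → Poly n) (b : A → Bool) xs →
  sumP (map f xs) ⊖ sumP (map f (filterᵇ b xs)) ≈ sumP (map f (filterᵇ (not ∘ b) xs))
sumP-⊖-filter f b xs = ≈i coeffs
  where
  kept = filterᵇ b xs
  dropped = filterᵇ (not ∘ b) xs
  coeffs : ∀ e → coeff (sumP (map f xs) ⊖ sumP (map f kept)) e ≡ coeff (sumP (map f dropped)) e
  coeffs e = begin
      coeff (sumP (map f xs) ⊖ sumP (map f kept)) e
    ≡⟨ trans (coeff-++ (sumP (map f xs)) _ e) (cong₂ _+_ (coeff-sumP f xs e) (trans (coeff-neg (sumP (map f kept)) e) (cong ℚ.-_ (coeff-sumP f kept e)))) ⟩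
      ∑ xs c + ℚ.- ∑ kept c
    ≡⟨ cong (λ u → u + ℚ.- ∑ kept c) (trans (∑-cong xs (λ x → split (b x) (c x))) (∑-+ xs _ _)) ⟩
      (∑ xs (λ x → if b x then c x else 0ℚ) + ∑ xs (λ x → if not (b x) then c x else 0ℚ)) + ℚ.- ∑ kept c
    ≡⟨ cong₂ (λ u v → (u + v) + ℚ.- ∑ kept c) (sym (∑-filter b xs c)) (sym (∑-filter (not ∘ b) xs c)) ⟩
      (∑ kept c + ∑ dropped c) + ℚ.- ∑ kept c
    ≡⟨ cancel (∑ kept c) (∑ dropped c) ⟩
      ∑ dropped c
    ≡⟨ sym (coeff-sumP f dropped e) ⟩
      coeff (sumP (map f dropped)) e ∎
    where
    open ≡-Reasoning
    open ℚSolver.+-*-Solver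
    c = λ x → coeff (f x) e
    split : ∀ b q → q ≡ (if b then q else 0ℚ) + (if not b then q else 0ℚ)
    split true q = sym (ℚP.+-identityʳ q)
    split false q = sym (ℚP.+-identityˡ q)
    cancel : ∀ u v → (u + v) + ℚ.- u ≡ v
    cancel = solve 2 (λ u v → (u :+ v) :+ (:- u) := v) refl

module Expansion (m k : ℕ) (a : ℕ → ℕ → ℚ) (isExpansion : IsExpansion m k a) where

  summand : ∀ {n} → Fin n → ℕ × ℕ → Poly n
  summand i (l , r) = const (a l r) ⊗ basis m (var i) (l , r)

  factor-expansion : ∀ {n} (i : Fin n) → pow (ff (var i ⊖ one) m) k ≈ sumP (map (summand i) (I m k))
  factor-expansion i = begin
      pow (ff (var i ⊖ one) m) k
    ≈⟨ ≈-sym (≈-trans (embed-pow i (ff (x₀ ⊖ one) m) k)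
                      (pow-cong k (≈-trans (embed-ff i (x₀ ⊖ one) m) (ff-cong m (≡⇒≈ (embed-⊖-const i x₀ 1ℚ)))))) ⟩
      embed i (pow (ff (x₀ ⊖ one) m) k)
    ≈⟨ embed-cong i (≈i isExpansion) ⟩
      embed i (sumP (map summand₀ (I m k)))
    ≡⟨ embed-sumP i summand₀ (I m k) ⟩
      sumP (map (embed i ∘ summand₀) (I m k))
    ≈⟨ sumP-cong (I m k) (λ { (l , r) → ≈-trans (embed-⊗ i (const (a l r)) _) (⊗-cong (≡⇒≈ (embed-const i (a l r))) (embed-basis i m (l , r))) }) ⟩
      sumP (map (summand i) (I m k)) ∎
    where
    open ≈-Reasoning
    summand₀ : ℕ × ℕ → Poly 1
    summand₀ (l , r) = const (a l r) ⊗ basis m x₀ (l , r)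

  P-expansion : ∀ n → P m n k ≈ sumP (map (term m a) (tuples n (I m k)))
  P-expansion n = ≈-trans (≡⇒≈ (cong prodP (map-allFin (λ i → pow (ff (var i ⊖ one) m) k))))
    (≈-trans (prodP-sumP _ summand (I m k) factor-expansion) (sumP-cong (tuples n (I m k)) product≈term))
    where
    product≈term : ∀ t → prodP (tabulate (λ i → summand i (lookup t i))) ≈ term m a t
    product≈term t = ≈-trans (prodP-const-⊗ coefficient factor)
      (≡⇒≈ (sym (cong₂ (λ u v → const (foldr _*_ 1ℚ u) ⊗ prodP v) (map-allFin coefficient) (map-allFin factor))))
      where
      coefficient = λ i → a (proj₁ (lookup t i)) (proj₂ (lookup t i))
      factor = λ i → basis m (var i) (lookup t i)

  P⊖P₁-expansion : ∀ n → P m n k ⊖ P₁ m n k a ≈ sumP (map (term m a) (filterᵇ (not ∘ keep m k) (tuples n (I m k))))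
  P⊖P₁-expansion n = ≈-trans (⊖-cong (P-expansion n) ≈-refl) (sumP-⊖-filter (term m a) (keep m k) (tuples n (I m k)))

sumR : ∀ {n} → Vec (ℕ × ℕ) n → ℕ
sumR [] = 0
sumR ((l , r) ∷ t) = r ℕ.+ sumR t

sumL≡sum : ∀ {n} (t : Vec (ℕ × ℕ) n) → sumL t ≡ sum (λ i → proj₁ (lookup t i))
sumL≡sum [] = refl
sumL≡sum (x ∷ t) = cong (proj₁ x ℕ.+_) (sumL≡sum t)

sumDeg≡sum : ∀ {n} m (t : Vec (ℕ × ℕ) n) → sumDeg m t ≡ sum (λ i → suc m ℕ.* proj₁ (lookup t i) ℕ.+ proj₂ (lookup t i))
sumDeg≡sum m [] = refl
sumDeg≡sum m (x ∷ t) = cong (_ ℕ.+_) (sumDeg≡sum m t)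

sumDeg-split : ∀ {n} m (t : Vec (ℕ × ℕ) n) → sumDeg m t ≡ suc m ℕ.* sumL t ℕ.+ sumR t
sumDeg-split m [] = sym (cong (ℕ._+ 0) (ℕP.*-zeroʳ (suc m)))
sumDeg-split m ((l , r) ∷ t) = trans (cong ((suc m ℕ.* l ℕ.+ r) ℕ.+_) (sumDeg-split m t)) (regroup (suc m) l r (sumL t) (sumR t))
  where
  open +-*-Solver
  regroup : ∀ M l r L R → (M ℕ.* l ℕ.+ r) ℕ.+ (M ℕ.* L ℕ.+ R) ≡ M ℕ.* (l ℕ.+ L) ℕ.+ (r ℕ.+ R)
  regroup = solve 5 (λ M l r L R → (M :* l :+ r) :+ (M :* L :+ R) := M :* (l :+ L) :+ (r :+ R)) refl

RsBoundedBy : ∀ {n} → ℕ → Vec (ℕ × ℕ) n → Set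
RsBoundedBy m t = ∀ i → proj₂ (lookup t i) ≤ m

sumR-≤ : ∀ {n} m (t : Vec (ℕ × ℕ) n) → RsBoundedBy m t → sumR t ≤ m ℕ.* n
sumR-≤ m [] r≤m = z≤n
sumR-≤ {suc n} m (x ∷ t) r≤m = subst (sumR (x ∷ t) ≤_) (sym (ℕP.*-suc m n)) (ℕP.+-mono-≤ (r≤m F.zero) (sumR-≤ m t (r≤m ∘ F.suc)))

sumR-maximal : ∀ {n} m (t : Vec (ℕ × ℕ) n) → RsBoundedBy m t → m ℕ.* n ≤ sumR t → ∀ i → proj₂ (lookup t i) ≡ m
sumR-maximal {suc n} m ((l , r) ∷ t) r≤m mn≤ = λ { F.zero → r≡m ; (F.suc i) → sumR-maximal m t (r≤m ∘ F.suc) rest≥ i }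
  where
  mn≤′ : m ℕ.+ m ℕ.* n ≤ r ℕ.+ sumR t
  mn≤′ = subst (_≤ r ℕ.+ sumR t) (ℕP.*-suc m n) mn≤
  r≡m : r ≡ m
  r≡m = ℕP.≤-antisym (r≤m F.zero)
    (ℕP.+-cancelʳ-≤ (m ℕ.* n) m r (ℕP.≤-trans mn≤′ (ℕP.+-monoʳ-≤ r (sumR-≤ m t (r≤m ∘ F.suc)))))
  rest≥ : m ℕ.* n ≤ sumR t
  rest≥ = ℕP.+-cancelˡ-≤ m (m ℕ.* n) (sumR t) (subst (λ z → m ℕ.+ m ℕ.* n ≤ z ℕ.+ sumR t) r≡m mn≤′)

discarded-tuple : ∀ {n} m k (t : Vec (ℕ × ℕ) n) → 1 ≤ m → 1 ≤ n → RsBoundedBy m t → keep m (suc k) t ≡ false →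
  (suc k ≤ sumL t) ⊎ ((sumL t ≡ k) × (∀ i → proj₂ (lookup t i) ≡ m))
discarded-tuple {n} m k t 1≤m 1≤n r≤m discarded with sumL t ≤ᵇ k in L≤ᵇk
... | false = inj₁ (ℕP.≰⇒> λ L≤k → subst T L≤ᵇk (ℕP.≤⇒≤ᵇ L≤k))
... | true = inj₂ (L≡k , sumR-maximal m t r≤m mn≤R)
  where
  L = sumL t
  N = m ℕ.* n ℕ.+ suc m ℕ.* k
  N≤deg : N ≤ suc m ℕ.* L ℕ.+ sumR t
  N≤deg = subst (N ≤_) (sumDeg-split m t) (pred-< (ℕP.≤-trans (ℕP.*-mono-≤ 1≤m 1≤n) (ℕP.m≤m+n (m ℕ.* n) _))
    (ℕP.≰⇒> λ deg≤ → subst T discarded (ℕP.≤⇒≤ᵇ deg≤)))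
    where
    pred-< : ∀ {a b} → 1 ≤ a → a ∸ 1 < b → a ≤ b
    pred-< {suc a} _ lt = lt
  k≤L : k ≤ L
  k≤L = ℕP.*-cancelˡ-≤ (suc m) (ℕP.+-cancelʳ-≤ (m ℕ.* n) (suc m ℕ.* k) (suc m ℕ.* L)
    (ℕP.≤-trans (ℕP.≤-reflexive (ℕP.+-comm (suc m ℕ.* k) (m ℕ.* n)))
      (ℕP.≤-trans N≤deg (ℕP.+-monoʳ-≤ (suc m ℕ.* L) (sumR-≤ m t r≤m)))))
  L≡k : L ≡ k
  L≡k = ℕP.≤-antisym (ℕP.≤ᵇ⇒≤ L k (subst T (sym L≤ᵇk) tt)) k≤L
  mn≤R : m ℕ.* n ≤ sumR t
  mn≤R = ℕP.+-cancelʳ-≤ (suc m ℕ.* k) (m ℕ.* n) (sumR t) (ℕP.≤-trans N≤deg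
    (ℕP.≤-reflexive (trans (cong (λ z → suc m ℕ.* z ℕ.+ sumR t) L≡k) (ℕP.+-comm (suc m ℕ.* k) (sumR t)))))

indicator : ∀ {n} → Fin n → Fin n → ℕ
indicator i j = if does (i F.≟ j) then 1 else 0

sum-indicator : ∀ {n} (i : Fin n) → sum (indicator i) ≡ 1
sum-indicator {suc n} F.zero = cong suc (sum-zero n)
  where
  sum-zero : ∀ n → sum (indicator (F.zero {n}) ∘ F.suc) ≡ 0
  sum-zero zero = refl
  sum-zero (suc n) = sum-zero n
sum-indicator {suc n} (F.suc i) = sum-indicator i

ℕtoℚ-suc : ∀ x → ℕtoℚ (suc x) ≡ 1ℚ + ℕtoℚ x
ℕtoℚ-suc x = ℚP.toℚᵘ-injective (ℚᵘP.≃-trans (asℚᵘ (suc x)) (ℚᵘP.≃-trans (ℚᵘ.*≡* (ℤ-identity x))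
  (ℚᵘP.≃-sym (ℚᵘP.≃-trans (ℚP.toℚᵘ-homo-+ 1ℚ (ℕtoℚ x)) (ℚᵘP.+-cong (asℚᵘ 1) (asℚᵘ x))))))
  where
  asℚᵘ : ∀ n → ℚ.toℚᵘ (ℕtoℚ n) ℚᵘ.≃ ℚᵘ.mkℚᵘ (ℤ.+ n) 0
  asℚᵘ n = ℚP.toℚᵘ-fromℚᵘ (ℚᵘ.mkℚᵘ (ℤ.+ n) 0)
  ℤ-identity : ∀ x → ℤ.+ suc x ℤ.* (ℤ.+ 1 ℤ.* ℤ.+ 1) ≡ (ℤ.+ 1 ℤ.* ℤ.+ 1 ℤ.+ ℤ.+ x ℤ.* ℤ.+ 1) ℤ.* ℤ.+ 1
  ℤ-identity x = trans (ℤP.*-identityʳ (ℤ.+ suc x)) (sym (trans (ℤP.*-identityʳ _) (cong (ℤ._+_ (ℤ.+ 1)) (ℤP.*-identityʳ (ℤ.+ x)))))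

termCoeff : ∀ {n} → (ℕ → ℕ → ℚ) → Vec (ℕ × ℕ) n → ℚ
termCoeff {n} a t = foldr _*_ 1ℚ (map (λ i → a (proj₁ (lookup t i)) (proj₂ (lookup t i))) (allFin n))

module AtPoint (m : ℕ) {n} (p : Vec ℕ n) (p≤m : All (_≤ m) p) where

  pᵢ≤m : ∀ i → lookup p i ≤ m
  pᵢ≤m = VecAllP.lookup⁺ p≤m

  shift-ff-var : ∀ i s → shift (ff (var i) s) p ≈ ff (shiftedVar p i) s
  shift-ff-var i s = ≈-trans (shift-ff p (var i) s) (ff-cong s (shift-var p i))

  OrderAtLeast-ff-var : ∀ i → OrderAtLeast 1 (shift (ff (var i) (suc m)) p)
  OrderAtLeast-ff-var i = OrderAtLeast-resp (≈-sym (shift-ff-var i (suc m)))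
    (OrderAtLeast-ff (shiftedVar p i) (suc m) (lookup p i) (s≤s (pᵢ≤m i))
      (OrderAtLeast-resp (≈-sym (⊕-const-⊖-const (var i) _ _ (ℚP.+-inverseʳ (ℕtoℚ (lookup p i))))) (OrderAtLeast-var i)))

  OrderAtLeast-pow-ff : ∀ i l → OrderAtLeast l (shift (pow (ff (var i) (suc m)) l) p)
  OrderAtLeast-pow-ff i l = OrderAtLeast-resp (≈-sym (shift-pow p _ l))
    (OrderAtLeast-weaken (ℕP.≤-reflexive (sym (ℕP.*-identityʳ l))) (OrderAtLeast-pow l (OrderAtLeast-ff-var i)))

  OrderAtLeast-basis : ∀ i l r → OrderAtLeast l (shift (basis m (var i) (l , r)) p)
  OrderAtLeast-basis i l r = OrderAtLeast-resp (≈-sym (shift-⊗ p (pow (ff (var i) (suc m)) l) _))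
    (OrderAtLeast-weaken (ℕP.≤-reflexive (sym (ℕP.+-identityʳ l))) (OrderAtLeast-⊗ (OrderAtLeast-pow-ff i l) (OrderAtLeast-0 _)))

  -- For r = m the second factor is (x_i - 1)^{\underline m}, which vanishes at 1, …, m.
  OrderAtLeast-basis-m : ∀ i l → lookup p i ≢ 0 → OrderAtLeast (suc l) (shift (basis m (var i) (l , m)) p)
  OrderAtLeast-basis-m i l pᵢ≢0 with lookup p i in pᵢ≡
  ... | zero = ⊥-elim (pᵢ≢0 refl)
  ... | suc w = OrderAtLeast-resp (≈-sym (shift-⊗ p (pow (ff (var i) (suc m)) l) _))
      (OrderAtLeast-weaken (ℕP.≤-reflexive (ℕP.+-comm 1 l)) (OrderAtLeast-⊗ (OrderAtLeast-pow-ff i l) second-factor))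
    where
    c = ℕtoℚ m ℚ.- ℕtoℚ (suc m)
    pᵢ = ℕtoℚ (lookup p i)
    y = shiftedVar p i ⊕ const c
    w-root : ℕtoℚ (lookup p i) + c + ℚ.- ℕtoℚ w ≡ 0ℚ
    w-root = trans (cong (λ z → ℕtoℚ z + c + ℚ.- ℕtoℚ w) pᵢ≡)
      (trans (cong₂ (λ u v → u + (ℕtoℚ m ℚ.- v) + ℚ.- ℕtoℚ w) (ℕtoℚ-suc w) (ℕtoℚ-suc m))
        (solve 2 (λ W M → (con 1ℚ :+ W) :+ (M :- (con 1ℚ :+ M)) :+ (:- W) := con 0ℚ) refl (ℕtoℚ w) (ℕtoℚ m)))
      where open ℚSolver.+-*-Solver
    y⊖w≈var : y ⊖ const (ℕtoℚ w) ≈ var i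
    y⊖w≈var = ≈-trans
      (⊖-cong (≈-trans (⊕-assoc (var i) (const pᵢ) (const c)) (⊕-cong (≈-refl {p = var i}) (const-⊕-const pᵢ c))) (≈-refl {p = const (ℕtoℚ w)}))
      (⊕-const-⊖-const (var i) (ℕtoℚ (lookup p i) + c) (ℕtoℚ w) w-root)
    second-factor : OrderAtLeast 1 (shift (ff (var i ⊕ const c) m) p)
    second-factor = OrderAtLeast-resp
      (≈-sym (≈-trans (shift-ff p (var i ⊕ const c) m) (ff-cong m (≈-trans (shift-⊕ p (var i) (const c)) (⊕-cong (shift-var p i) (shift-const p c))))))
      (OrderAtLeast-ff y m w (subst (_≤ m) pᵢ≡ (pᵢ≤m i)) (OrderAtLeast-resp (≈-sym y⊖w≈var) (OrderAtLeast-var i)))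

  module _ (a : ℕ → ℕ → ℚ) (t : Vec (ℕ × ℕ) n) where

    shift-term : shift (term m a t) p ≈ const (termCoeff a t) ⊗ prodP (tabulate (λ i → shift (basis m (var i) (lookup t i)) p))
    shift-term = ≈-trans (shift-⊗ p (const (termCoeff a t)) (prodP (map factor (allFin n)))) (⊗-cong (shift-const p (termCoeff a t))
      (≈-trans (shift-prodP p (allFin n) factor) (≡⇒≈ (cong prodP (map-allFin (λ i → shift (factor i) p))))))
      where factor = λ i → basis m (var i) (lookup t i)

    OrderAtLeast-term : OrderAtLeast (sumL t) (shift (term m a t) p)
    OrderAtLeast-term = OrderAtLeast-resp (≈-sym shift-term) (OrderAtLeast-const-⊗ (termCoeff a t)
      (OrderAtLeast-weaken (ℕP.≤-reflexive (sumL≡sum t))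
        (OrderAtLeast-prodP (λ i → shift (basis m (var i) (lookup t i)) p) (λ i → proj₁ (lookup t i))
          (λ i → OrderAtLeast-basis i (proj₁ (lookup t i)) (proj₂ (lookup t i))))))

    OrderAtLeast-term-m : ∀ j → lookup p j ≢ 0 → (∀ i → proj₂ (lookup t i) ≡ m) → OrderAtLeast (suc (sumL t)) (shift (term m a t) p)
    OrderAtLeast-term-m j pⱼ≢0 r≡m = OrderAtLeast-resp (≈-sym shift-term) (OrderAtLeast-const-⊗ (termCoeff a t)
      (OrderAtLeast-weaken (ℕP.≤-reflexive orders-sum) (OrderAtLeast-prodP (λ i → shift (basis m (var i) (lookup t i)) p) order factor-order)))
      where
      order : Fin n → ℕ
      order i = proj₁ (lookup t i) ℕ.+ indicator j i
      orders-sum : suc (sumL t) ≡ sum order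
      orders-sum = sym (trans (∑-distrib-+ _ (indicator j)) (trans (cong₂ ℕ._+_ (sym (sumL≡sum t)) (sum-indicator j)) (ℕP.+-comm (sumL t) 1)))
      factor-order : ∀ i → OrderAtLeast (order i) (shift (basis m (var i) (lookup t i)) p)
      factor-order i with j F.≟ i
      ... | yes refl = OrderAtLeast-weaken (ℕP.≤-reflexive (ℕP.+-comm (proj₁ (lookup t i)) 1))
        (subst (λ r → OrderAtLeast (suc (proj₁ (lookup t i))) (shift (basis m (var i) (proj₁ (lookup t i) , r)) p)) (sym (r≡m i))
          (OrderAtLeast-basis-m i _ pⱼ≢0))
      ... | no _ = OrderAtLeast-weaken (ℕP.≤-reflexive (ℕP.+-identityʳ _)) (OrderAtLeast-basis i (proj₁ (lookup t i)) (proj₂ (lookup t i)))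

-- Componentwise order on exponent vectors; a record, so that both sides can be inferred.
record _≼_ {n} (d b : Mono n) : Set where
  constructor ≼i
  field lookup-≤ : d ∣M b
open _≼_ public

≼-⊹ : ∀ {n} {d d' b b' : Mono n} → d ≼ b → d' ≼ b' → (d ⊹ d') ≼ (b ⊹ b')
≼-⊹ {d = d} {d'} {b} {b'} d≼b d'≼b' = ≼i λ j →
  subst₂ _≤_ (sym (lookup-⊹ d d' j)) (sym (lookup-⊹ b b' j)) (ℕP.+-mono-≤ (lookup-≤ d≼b j) (lookup-≤ d'≼b' j))

𝟎≼ : ∀ {n} (b : Mono n) → 𝟎 ≼ b
𝟎≼ b = ≼i λ j → subst (_≤ lookup b j) (sym (lookup-replicate j 0)) z≤n

AllMonos≼-⊗ : ∀ {n} {b b' : Mono n} {p q} → AllMonos (_≼ b) p → AllMonos (_≼ b') q → AllMonos (_≼ (b ⊹ b')) (p ⊗ q)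
AllMonos≼-⊗ bp bq = AllMonos-⊗ bp bq (λ d d' → ≼-⊹)

AllMonos≼-const : ∀ {n} (b : Mono n) c → AllMonos (_≼ b) (const c)
AllMonos≼-const b c = 𝟎≼ b All.∷ All.[]

AllMonos-neg : ∀ {n} {S : Mono n → Set} {p} → AllMonos S p → AllMonos S (neg p)
AllMonos-neg Sp = AllP.map⁺ (All.map id Sp)

AllMonos≼-pow : ∀ {n} (i : Fin n) {y : Poly n} b → AllMonos (_≼ single i b) y → ∀ l → AllMonos (_≼ single i (l ℕ.* b)) (pow y l)
AllMonos≼-pow i b by zero = AllMonos≼-const (single i 0) 1ℚ
AllMonos≼-pow i {y} b by (suc l) = subst (λ z → AllMonos (_≼ z) (pow y (suc l)))
  (trans (single-⊹ i (l ℕ.* b) b) (cong (single i) (ℕP.+-comm (l ℕ.* b) b))) (AllMonos≼-⊗ (AllMonos≼-pow i b by l) by)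

AllMonos≼-ff : ∀ {n} (i : Fin n) {y : Poly n} → AllMonos (_≼ single i 1) y → ∀ s → AllMonos (_≼ single i s) (ff y s)
AllMonos≼-ff i by zero = AllMonos≼-const (single i 0) 1ℚ
AllMonos≼-ff i {y} by (suc s) = subst (λ z → AllMonos (_≼ z) (ff y (suc s)))
  (trans (single-⊹ i s 1) (cong (single i) (ℕP.+-comm s 1)))
  (AllMonos≼-⊗ (AllMonos≼-ff i by s) (AllMonos-++ by (AllMonos-neg (AllMonos≼-const (single i 1) (ℕtoℚ s)))))

AllMonos≼-basis : ∀ {n} m (i : Fin n) l r → AllMonos (_≼ single i (suc m ℕ.* l ℕ.+ r)) (basis m (var i) (l , r))
AllMonos≼-basis m i l r = subst (λ z → AllMonos (_≼ z) (basis m (var i) (l , r)))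
  (trans (single-⊹ i _ r) (cong (λ z → single i (z ℕ.+ r)) (ℕP.*-comm l (suc m))))
  (AllMonos≼-⊗ (AllMonos≼-pow i (suc m) (AllMonos≼-ff i var≼ (suc m)) l)
                (AllMonos≼-ff i (AllMonos-++ var≼ (AllMonos≼-const (single i 1) _)) r))
  where
  var≼ : AllMonos (_≼ single i 1) (var i)
  var≼ = ≼i (λ j → ℕP.≤-refl) All.∷ All.[]

⊹-sum : ∀ {n n'} → (Fin n' → Mono n) → Mono n
⊹-sum {n' = zero} b = 𝟎
⊹-sum {n' = suc n'} b = b F.zero ⊹ ⊹-sum (b ∘ F.suc)

AllMonos≼-prodP : ∀ {n n'} (g : Fin n' → Poly n) (b : Fin n' → Mono n) → (∀ i → AllMonos (_≼ b i) (g i)) →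
  AllMonos (_≼ ⊹-sum b) (prodP (tabulate g))
AllMonos≼-prodP {n' = zero} g b bg = AllMonos≼-const 𝟎 1ℚ
AllMonos≼-prodP {n' = suc n'} g b bg = AllMonos≼-⊗ (bg F.zero) (AllMonos≼-prodP (g ∘ F.suc) (b ∘ F.suc) (bg ∘ F.suc))

⊹-sum-single : ∀ {n} (f : Fin n → ℕ) → ⊹-sum (λ i → single i (f i)) ≡ V.tabulate f
⊹-sum-single {zero} f = refl
⊹-sum-single {suc n} f =
  trans (cong (single F.zero (f F.zero) ⊹_) (trans (⊹-sum-0∷ (λ i → single i (f (F.suc i)))) (cong (0 ∷_) (⊹-sum-single (f ∘ F.suc)))))
  (cong₂ _∷_ (ℕP.+-identityʳ (f F.zero)) (⊹-identityˡ _))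
  where
  ⊹-sum-0∷ : ∀ {n n'} (b : Fin n' → Mono n) → ⊹-sum (λ i → 0 ∷ b i) ≡ 0 ∷ ⊹-sum b
  ⊹-sum-0∷ {n' = zero} b = refl
  ⊹-sum-0∷ {n' = suc n'} b = cong ((0 ∷ b F.zero) ⊹_) (⊹-sum-0∷ (b ∘ F.suc))

AllMonos≼-term : ∀ {n} m (a : ℕ → ℕ → ℚ) (t : Vec (ℕ × ℕ) n) →
  AllMonos (_≼ V.tabulate (λ i → suc m ℕ.* proj₁ (lookup t i) ℕ.+ proj₂ (lookup t i))) (term m a t)
AllMonos≼-term {n} m a t = subst₂ (λ z w → AllMonos (_≼ z) (const (termCoeff a t) ⊗ prodP w))
  (trans (⊹-identityˡ _) (⊹-sum-single _)) (sym (map-allFin factor))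
  (AllMonos≼-⊗ (AllMonos≼-const 𝟎 (termCoeff a t))
    (AllMonos≼-prodP factor _ (λ i → AllMonos≼-basis m i (proj₁ (lookup t i)) (proj₂ (lookup t i)))))
  where factor = λ i → basis m (var i) (lookup t i)

occurrences : ∀ {n k} → Vec (Fin n) k → Fin n → ℕ
occurrences [] j = 0
occurrences (i ∷ is) j = indicator i j ℕ.+ occurrences is j

lookup-powMono : ∀ {n k} m (is : Vec (Fin n) k) j → lookup (powMono m is) j ≡ suc m ℕ.* occurrences is j
lookup-powMono m [] j = trans (lookup-replicate j 0) (sym (ℕP.*-zeroʳ (suc m)))
lookup-powMono m (i ∷ is) j = begin
    lookup (single i (suc m) ⊹ powMono m is) j
  ≡⟨ trans (lookup-⊹ (single i (suc m)) (powMono m is) j) (cong₂ ℕ._+_ (lookup-single i j (suc m)) (lookup-powMono m is j)) ⟩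
    (if does (i F.≟ j) then suc m else 0) ℕ.+ suc m ℕ.* occurrences is j
  ≡⟨ cong (ℕ._+ suc m ℕ.* occurrences is j) (scaled-indicator (does (i F.≟ j))) ⟩
    suc m ℕ.* indicator i j ℕ.+ suc m ℕ.* occurrences is j
  ≡⟨ sym (ℕP.*-distribˡ-+ (suc m) (indicator i j) (occurrences is j)) ⟩
    suc m ℕ.* occurrences (i ∷ is) j ∎
  where
  open ≡-Reasoning
  scaled-indicator : ∀ b → (if b then suc m else 0) ≡ suc m ℕ.* (if b then 1 else 0)
  scaled-indicator true = sym (ℕP.*-identityʳ (suc m))
  scaled-indicator false = sym (ℕP.*-zeroʳ (suc m))

sum-occurrences : ∀ {n k} (is : Vec (Fin n) k) → sum (occurrences is) ≡ k
sum-occurrences {n} [] = sum-zero n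
  where
  sum-zero : ∀ n → sum {n} (λ _ → 0) ≡ 0
  sum-zero zero = refl
  sum-zero (suc n) = sum-zero n
sum-occurrences (i ∷ is) = trans (∑-distrib-+ (indicator i) (occurrences is)) (cong₂ ℕ._+_ (sum-indicator i) (sum-occurrences is))

sum-mono : ∀ {n} {f g : Fin n → ℕ} → (∀ i → f i ≤ g i) → sum f ≤ sum g
sum-mono {zero} f≤g = z≤n
sum-mono {suc n} f≤g = ℕP.+-mono-≤ (f≤g F.zero) (sum-mono (f≤g ∘ F.suc))

-- Since r ≤ m, the exponent (m+1) l + r of x_j holds at most l factors x_j^{m+1}.
cancel-*-≤-with-remainder : ∀ m {c l r} → suc m ℕ.* c ≤ suc m ℕ.* l ℕ.+ r → r ≤ m → c ≤ l
cancel-*-≤-with-remainder m {c} {l} {r} mc≤ r≤m = ℕP.≮⇒≥ λ l<c → ℕP.<⇒≱ (s≤s r≤m) (ℕP.+-cancelˡ-≤ (suc m ℕ.* l) (suc m) r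
  (ℕP.≤-trans (ℕP.≤-reflexive (trans (ℕP.+-comm (suc m ℕ.* l) (suc m)) (sym (ℕP.*-suc (suc m) l))))
    (ℕP.≤-trans (ℕP.*-monoʳ-≤ (suc m) l<c) mc≤)))

VMonomial : ∀ {n} → ℕ → ℕ → Mono n → Set
VMonomial {n} m k e = (degM e ≤ m ℕ.* n ℕ.+ suc m ℕ.* (k ∸ 1) ∸ 1) × (¬ ∃ λ (is : Vec (Fin n) k) → powMono m is ∣M e)

AllMonos-V-term : ∀ {n} m k (a : ℕ → ℕ → ℚ) → 1 ≤ k → (t : Vec (ℕ × ℕ) n) → RsBoundedBy m t → T (keep m k t) →
  AllMonos (VMonomial m k) (term m a t)
AllMonos-V-term {n} m k a 1≤k t r≤m kept = All.map (λ {x} → inV (proj₂ x) ∘ lookup-≤) (AllMonos≼-term m a t)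
  where
  bound : Fin n → ℕ
  bound j = suc m ℕ.* proj₁ (lookup t j) ℕ.+ proj₂ (lookup t j)
  tests = Equivalence.to T-∧ kept
  sumL≤ : sumL t ≤ k ∸ 1
  sumL≤ = ℕP.≤ᵇ⇒≤ _ _ (proj₁ tests)
  sumDeg≤ : sumDeg m t ≤ m ℕ.* n ℕ.+ suc m ℕ.* (k ∸ 1) ∸ 1
  sumDeg≤ = ℕP.≤ᵇ⇒≤ _ _ (proj₂ tests)
  inV : ∀ e → e ∣M V.tabulate bound → VMonomial m k e
  inV e e≤ = degree≤ , not-divisible
    where
    eⱼ≤ : ∀ j → lookup e j ≤ bound j
    eⱼ≤ j = subst (lookup e j ≤_) (lookup∘tabulate bound j) (e≤ j)
    degree≤ = ℕP.≤-trans (ℕP.≤-reflexive (degM-sum e)) (ℕP.≤-trans (sum-mono eⱼ≤) (ℕP.≤-trans (ℕP.≤-reflexive (sym (sumDeg≡sum m t))) sumDeg≤))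
    not-divisible : ¬ ∃ λ (is : Vec (Fin n) k) → powMono m is ∣M e
    not-divisible (is , is∣e) = ℕP.<⇒≱ (ℕP.<-≤-trans sumL<k (ℕP.≤-reflexive (sym (sum-occurrences is))))
      (ℕP.≤-trans (sum-mono λ j → cancel-*-≤-with-remainder m (subst (_≤ bound j) (lookup-powMono m is j) (ℕP.≤-trans (is∣e j) (eⱼ≤ j))) (r≤m j))
        (ℕP.≤-reflexive (sym (sumL≡sum t))))
      where
      sumL<k : sumL t < k
      sumL<k = ℕP.<-≤-trans (s≤s sumL≤) (ℕP.≤-reflexive (trans (ℕP.+-comm 1 (k ∸ 1)) (ℕP.m∸n+n≡m 1≤k)))

nonzero-coordinate : ∀ {n} (p : Vec ℕ n) → p ≢ replicate n 0 → ∃ λ j → lookup p j ≢ 0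
nonzero-coordinate [] p≢0 = ⊥-elim (p≢0 refl)
nonzero-coordinate (zero ∷ p) p≢0 with nonzero-coordinate p (p≢0 ∘ cong (0 ∷_))
... | j , pⱼ≢0 = F.suc j , pⱼ≢0
nonzero-coordinate (suc x ∷ p) _ = F.zero , λ ()

OrderAtLeast-sumP : ∀ {n} {A : Set} {R : A → Set} {j} (g : A → Poly n) xs → AllL R xs → (∀ x → R x → OrderAtLeast j (g x)) → OrderAtLeast j (sumP (map g xs))
OrderAtLeast-sumP g xs Rxs o = orderAtLeast λ e lt → trans (coeff-sumP g xs e) (∑-vanishes xs Rxs (λ x Rx → vanish (o x Rx) e lt))

I-bounded : ∀ m k → AllL (λ t → proj₂ t ≤ m) (I m k)
I-bounded m k = ℕP.≤-refl All.∷ concatMap-bounded (map suc (L.upTo (q m k)))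
  where
  concatMap-bounded : ∀ ls → AllL (λ t → proj₂ t ≤ m) (concatMap (λ l → map (l ,_) (L.upTo (suc m))) ls)
  concatMap-bounded [] = All.[]
  concatMap-bounded (l ∷ ls) = AllP.++⁺ (AllP.map⁺ (AllP.applyUpTo⁺₁ id (suc m) ℕP.≤-pred)) (concatMap-bounded ls)

All-tuples : ∀ {A : Set} {Q : A → Set} n (xs : List A) → AllL Q xs → AllL (λ t → ∀ i → Q (lookup t i)) (tuples n xs)
All-tuples zero xs Qxs = (λ ()) All.∷ All.[]
All-tuples {Q = Q} (suc n) xs Qxs = concatMap-all (tuples n xs) (All-tuples n xs Qxs)
  where
  concatMap-all : ∀ ts → AllL (λ t → ∀ i → Q (lookup t i)) ts → AllL (λ t → ∀ i → Q (lookup t i)) (concatMap (λ t → map (_∷ t) xs) ts)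
  concatMap-all [] All.[] = All.[]
  concatMap-all (t ∷ ts) (Qt All.∷ Qts) = AllP.++⁺ (AllP.map⁺ (All.map (λ Qx → λ { F.zero → Qx ; (F.suc i) → Qt i }) Qxs)) (concatMap-all ts Qts)

P₁-in-V : ∀ m n k (a : ℕ → ℕ → ℚ) → 1 ≤ k → InV m k (P₁ m n k a)
P₁-in-V m n k a 1≤k e coeff≢0 = coeff≢0⇒inside (AllMonos-sumP (term m a) kept kept-in-V) coeff≢0
  where
  ts = tuples n (I m k)
  kept = filterᵇ (keep m k) ts
  kept-in-V : AllL (AllMonos (VMonomial m k) ∘ term m a) kept
  kept-in-V = All.map (λ {t} (r≤m , t-kept) → AllMonos-V-term m k a 1≤k t r≤m t-kept)
    (All.zip (AllP.filter⁺ (T? ∘ keep m k) (All-tuples n (I m k) (I-bounded m k)) , AllP.all-filter (T? ∘ keep m k) ts))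

module Vanishing (m : ℕ) {n} (k : ℕ) (1≤m : 1 ≤ m) (1≤n : 1 ≤ n) (a : ℕ → ℕ → ℚ) (isExpansion : IsExpansion m (suc k) a)
                 (p : Vec ℕ n) (p≤m : All (_≤ m) p) where
  open Expansion m (suc k) a isExpansion
  open AtPoint m p p≤m

  order-from-dropped : ∀ j → (∀ t → RsBoundedBy m t → keep m (suc k) t ≡ false → OrderAtLeast j (shift (term m a t) p)) →
    OrderAtLeast j (shift (P m n (suc k) ⊖ P₁ m n (suc k) a) p)
  order-from-dropped j o = OrderAtLeast-resp (≈-sym (≈-trans (shift-cong p (P⊖P₁-expansion n)) (shift-sumP p (term m a) dropped)))
    (OrderAtLeast-sumP (λ t → shift (term m a t) p) dropped dropped-bounded λ t (r≤m , t-dropped) → o t r≤m (Equivalence.to T-not-≡ t-dropped))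
    where
    ts = tuples n (I m (suc k))
    dropped = filterᵇ (not ∘ keep m (suc k)) ts
    dropped-bounded : AllL (λ t → RsBoundedBy m t × T (not (keep m (suc k) t))) dropped
    dropped-bounded = All.zip (AllP.filter⁺ (T? ∘ (not ∘ keep m (suc k))) (All-tuples n (I m (suc k)) (I-bounded m (suc k))) ,
                               AllP.all-filter (T? ∘ (not ∘ keep m (suc k))) ts)

  order-away-from-origin : p ≢ replicate n 0 → OrderAtLeast (suc k) (shift (P m n (suc k) ⊖ P₁ m n (suc k) a) p)
  order-away-from-origin p≢0 = order-from-dropped (suc k) λ t r≤m t-dropped → case t (discarded-tuple m k t 1≤m 1≤n r≤m t-dropped)
    where
    case : ∀ t → (suc k ≤ sumL t) ⊎ ((sumL t ≡ k) × (∀ i → proj₂ (lookup t i) ≡ m)) → OrderAtLeast (suc k) (shift (term m a t) p)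
    case t (inj₁ suc-k≤) = OrderAtLeast-weaken suc-k≤ (OrderAtLeast-term a t)
    case t (inj₂ (sumL≡k , r≡m)) = OrderAtLeast-weaken (ℕP.≤-reflexive (cong suc (sym sumL≡k)))
      (OrderAtLeast-term-m a t (proj₁ (nonzero-coordinate p p≢0)) (proj₂ (nonzero-coordinate p p≢0)) r≡m)

  order-at-origin : OrderAtLeast k (shift (P m n (suc k) ⊖ P₁ m n (suc k) a) p)
  order-at-origin = order-from-dropped k λ t r≤m t-dropped → case t (discarded-tuple m k t 1≤m 1≤n r≤m t-dropped)
    where
    case : ∀ t → (suc k ≤ sumL t) ⊎ ((sumL t ≡ k) × (∀ i → proj₂ (lookup t i) ≡ m)) → OrderAtLeast k (shift (term m a t) p)
    case t (inj₁ suc-k≤) = OrderAtLeast-weaken (ℕP.≤-trans (ℕP.n≤1+n k) suc-k≤) (OrderAtLeast-term a t)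
    case t (inj₂ (sumL≡k , _)) = OrderAtLeast-weaken (ℕP.≤-reflexive (sym sumL≡k)) (OrderAtLeast-term a t)

lemma6p2 : (m n k : ℕ) → 1 ≤ m → 1 ≤ n → 2 ≤ k →
    (a : ℕ → ℕ → ℚ) → IsExpansion m k a →
    InV m k (P₁ m n k a)
    × (∀ (p : Vec ℕ n) → All (_≤ m) p →
        (p ≢ replicate n 0 → MultAtLeast (P m n k ⊖ P₁ m n k a) p k)
        × (p ≡ replicate n 0 → MultAtLeast (P m n k ⊖ P₁ m n k a) p (k ∸ 1)))
lemma6p2 m n (suc k) 1≤m 1≤n (s≤s _) a isExpansion = P₁-in-V m n (suc k) a (s≤s z≤n) , λ p p≤m →
  let open Vanishing m k 1≤m 1≤n a isExpansion p p≤m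
  in (λ p≢0 → vanish (order-away-from-origin p≢0)) , (λ _ → vanish order-at-origin)
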